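{- Let $d\geq2$ and $m$ be positive integers, and let $$\Delta=\mathrm{conv}\Big\{\mathbf{0},\mathbf{e}_1,\ldots,\mathbf{e}_{d-1},\,m2^{d-1}\mathbf{e}_d-\sum_{i=1}^{d-1}2^{i-1}\mathbf{e}_i\Big\}\subset\mathbb{R}^d$$ (i.e. $\Delta(0,q^{(m)})$ for $q=(-2^0,-2^1,\ldots,-2^{d-2},2^{d-1})\in\mathbb{Z}^d$). Then $$h^*_{\Delta}(x)=((m-1)x+1)(1+x)^{d-1}.$$
   Context: $\mathbf{e}_i$ is the $i$-th unit coordinate vector of $\mathbb{R}^d$ and $\mathbf{0}$ the origin. For a $d$-dimensional integral polytope $\mathcal{P}$ with Ehrhart polynomial $i(\mathcal{P},t)=\#(t\mathcal{P}\cap\mathbb{Z}^d)$, the $h^*$-polynomial is defined by $1+\sum_{t\geq1}i(\mathcal{P},t)x^t=h^*_{\mathcal{P}}(x)/(1-x)^{d+1}$. -}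

module Defs where

open import Data.Nat as ℕ using (ℕ; zero; suc; _∸_; _^_; _≟_)
open import Data.Nat.Combinatorics using (_C_)
open import Data.Integer as ℤ using (ℤ; +_)
open import Data.Rational as ℚ using (ℚ; 0ℚ; 1ℚ; _/_)
open import Data.Fin using (Fin; toℕ)
open import Data.Vec using (Vec; lookup; tabulate)
open import Data.List using (List; length)
open import Data.List.Membership.Propositional using (_∈_)
open import Data.List.Relation.Unary.Unique.Propositional using (Unique)
open import Data.Product using (Σ; ∃; _×_)
open import Function.Bundles using (_⇔_)
open import Relation.Nullary using (does)
open import Data.Bool using (if_then_else_)
open import Relation.Binary.PropositionalEquality using (_≡_)

ΣQ : (n : ℕ) → (Fin n → ℚ) → ℚ
ΣQ zero f = 0ℚ
ΣQ (suc n) f = f Fin.zero ℚ.+ ΣQ n (λ k → f (Fin.suc k))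

InConv : {d n : ℕ} → (Fin n → Vec ℚ d) → Vec ℚ d → Set
InConv {d} {n} V q =
  Σ (Fin n → ℚ) λ λs →
    (∀ k → 0ℚ ℚ.≤ λs k) × (ΣQ n λs ≡ 1ℚ) ×
    (∀ (j : Fin d) → lookup q j ≡ ΣQ n (λ k → λs k ℚ.* lookup (V k) j))

InDilate : {d n : ℕ} → ℕ → (Fin n → Vec ℚ d) → Vec ℤ d → Set
InDilate {d} t V p =
  Σ (Vec ℚ d) λ q → InConv V q ×
    (∀ (j : Fin d) → (lookup p j / 1) ≡ ((+ t) / 1) ℚ.* lookup q j)

HasCard : {d : ℕ} → (Vec ℤ d → Set) → ℕ → Set
HasCard {d} S c =
  Σ (List (Vec ℤ d)) λ xs → Unique xs × (∀ p → (S p ⇔ (p ∈ xs))) × (length xs ≡ c)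

-- vertices of Δ(0, q^{(m)}) ⊂ ℝ^d, indexed by Fin (d+1):
-- vertex 0 = 0, vertex k = e_k (1 ≤ k ≤ d-1),
-- vertex d = m 2^{d-1} e_d - Σ_{i=1}^{d-1} 2^{i-1} e_i
-- (coordinate j : Fin d stands for e_{toℕ j + 1})
ΔVert : (d m : ℕ) → Fin (suc d) → Vec ℚ d
ΔVert d m k = tabulate λ j →
  if does (toℕ k ≟ d)
  then (if does (suc (toℕ j) ≟ d)
        then (+ (m ℕ.* 2 ^ (d ∸ 1))) / 1
        else ℚ.- ((+ (2 ^ toℕ j)) / 1))
  else (if does (toℕ k ≟ suc (toℕ j)) then 1ℚ else 0ℚ)

-- Ehrhart series coefficients: 1 + Σ_{t≥1} i(t) x^t
ehrSeries : (ℕ → ℕ) → ℕ → ℤ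
ehrSeries i zero = + 1
ehrSeries i (suc t) = + i (suc t)

-- coefficient of x^n in (1-x)^{D} · F(x), i.e. Σ_{k=0}^{n} (-1)^k C(D,k) F(n-k)
signedBinom : ℕ → ℕ → ℤ
signedBinom D k = (ℤ.- (+ 1)) ℤ.^ k ℤ.* (+ (D C k))

timesOneMinusXPow : ℕ → (ℕ → ℤ) → ℕ → ℤ
timesOneMinusXPow D F n = go n
  where
  go : ℕ → ℤ
  go zero = signedBinom D 0 ℤ.* F n
  go (suc k) = go k ℤ.+ signedBinom D (suc k) ℤ.* F (n ∸ suc k)

-- coefficient of x^n in ((m-1)x + 1)(1+x)^{d-1}
targetCoeff : (d m : ℕ) → ℕ → ℤ
targetCoeff d m zero = + ((d ∸ 1) C 0)
targetCoeff d m (suc n) = + ((d ∸ 1) C suc n) ℤ.+ (+ (m ∸ 1)) ℤ.* (+ ((d ∸ 1) C n))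

-- A lattice point (p₀, …, p_{d−2}, y) lies in tΔ iff its barycentric coordinates are nonnegative;
-- up to positive factors these are y, the values m·2^{d−1−j}·p_j + y, and m·t − (m·Σ p + y).
-- Write y = m·V + w with 0 ≤ w < m.  The coordinate with the smallest facet coefficient, 2m, is then
-- at least −⌊V/2⌋.  Deleting it when the bound is attained (which leaves a point of (t − V mod 2)Δ
-- one dimension lower, with quotient ⌊V/2⌋) and lowering it by one otherwise (which leaves a point
-- of (t − 1)Δ) sets up a bijection, so the counts satisfy
-- i_{k+1}(t) = i_k(t) + i_k(t − 1) + i_{k+1}(t − 1), with i₀(t) = 1 + m·t for the segment [0, m].
-- For the series I_k = Σ_t i_k(t) xᵗ this says (1 − x)·I_{k+1} = (1 + x)·I_k and
-- (1 − x)²·I₀ = 1 + (m − 1)·x, whence (1 − x)^{d+1}·I_{d−1} = ((m − 1)·x + 1)(1 + x)^{d−1}.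

module Submission where

open import Defs
open import Algebra.Bundles using (Ring)
import Algebra.Properties.Semiring.Sum
open import Data.Bool.Base using (if_then_else_)
open import Data.Fin.Base as Fin using (Fin; toℕ; inject₁; fromℕ; fromℕ<; opposite)
import Data.Fin.Properties as Fin
open import Data.Integer.Base as ℤ using (ℤ; +_; -[1+_]; 0ℤ)
import Data.Integer.Properties as ℤ
open import Data.Integer.Tactic.RingSolver using (solve-∀)
open import Data.List.Base using (List; []; _∷_; [_]; _++_; map; allFin; length)
import Data.List.Properties as List
open import Data.List.Membership.Propositional using (_∈_)
open import Data.List.Membership.Propositional.Properties using (∈-map⁺; ∈-map⁻; ∈-++⁺ˡ; ∈-++⁺ʳ; ∈-++⁻; ∈-allFin)
open import Data.List.Relation.Unary.All using ([])
open import Data.List.Relation.Unary.AllPairs using ([]; _∷_)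
open import Data.List.Relation.Unary.Any using (here)
open import Data.List.Relation.Unary.Unique.Propositional using (Unique)
import Data.List.Relation.Unary.Unique.Propositional.Properties as Unique
open import Data.Nat.Base as ℕ using (ℕ; zero; suc; _∸_; _^_; _≤_; z≤n; s≤s)
open import Data.Nat.Combinatorics using (_C_; nCk+nC[k+1]≡[n+1]C[k+1])
open import Data.Nat.Coprimality using (1-coprimeTo) renaming (sym to coprime-sym)
open import Data.Nat.DivMod using (m≡m%n+[m/n]*n; m%n<n; [m+kn]%n≡m%n; m<n⇒m%n≡m)
import Data.Nat.Properties as ℕ
open import Data.Nat.Properties using (_≟_)
import Data.Nat.Tactic.RingSolver as ℕ-Solver
open import Data.Product.Base using (Σ; ∃; _×_; _,_; proj₁; proj₂)
open import Data.Rational.Base as ℚ using (ℚ; mkℚ; 0ℚ; 1ℚ)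
import Data.Rational.Properties as ℚ
open import Data.Rational.Solver using (module +-*-Solver)
open import Data.Sum.Base using (_⊎_; inj₁; inj₂)
open import Data.Unit.Base using (⊤; tt)
open import Data.Vec.Base as Vec using (Vec; []; _∷_; _∷ʳ_; lookup; tabulate; reverse; initLast)
import Data.Vec.Properties as Vec
open import Function.Base using (_∘_)
open import Function.Bundles using (_⇔_; mk⇔; Equivalence)
open import Function.Properties.Equivalence using () renaming (sym to ⇔-sym; trans to ⇔-trans)
open import Relation.Nullary using (does)
open import Relation.Nullary.Decidable using (dec-true; dec-false)
open import Relation.Nullary.Negation using (¬_; contradiction)
open import Relation.Binary.PropositionalEquality
  using (_≡_; _≢_; refl; sym; trans; cong; cong₂; subst; subst₂; module ≡-Reasoning)

module ℤΣ = Algebra.Properties.Semiring.Sum ℤ.+-*-semiring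
module ℚΣ = Algebra.Properties.Semiring.Sum (Ring.semiring ℚ.+-*-ring)
open import Algebra.Properties.Group ℚ.+-0-group using (∙-cancelʳ)

-- Power series

timesOneMinusX : (ℕ → ℤ) → ℕ → ℤ
timesOneMinusX F zero = F zero
timesOneMinusX F (suc n) = F (suc n) ℤ.- F n

timesOnePlusX : (ℕ → ℤ) → ℕ → ℤ
timesOnePlusX F zero = F zero
timesOnePlusX F (suc n) = F (suc n) ℤ.+ F n

timesOnePlusX-cong : ∀ {F G} → (∀ j → F j ≡ G j) → ∀ n → timesOnePlusX F n ≡ timesOnePlusX G n
timesOnePlusX-cong F≗G zero = F≗G zero
timesOnePlusX-cong F≗G (suc n) = cong₂ ℤ._+_ (F≗G (suc n)) (F≗G n)

timesOneMinusX-timesOnePlusX : ∀ F n →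
  timesOneMinusX (timesOnePlusX F) n ≡ timesOnePlusX (timesOneMinusX F) n
timesOneMinusX-timesOnePlusX F zero = refl
timesOneMinusX-timesOnePlusX F (suc zero) = regroup (F 1) (F 0)
  where
  regroup : ∀ a b → (a ℤ.+ b) ℤ.- b ≡ (a ℤ.- b) ℤ.+ b
  regroup = solve-∀
timesOneMinusX-timesOnePlusX F (suc (suc n)) = regroup (F (suc (suc n))) (F (suc n)) (F n)
  where
  regroup : ∀ a b c → (a ℤ.+ b) ℤ.- (b ℤ.+ c) ≡ (a ℤ.- b) ℤ.+ (b ℤ.- c)
  regroup = solve-∀

∸-suc : ∀ {n k} → k ℕ.< n → n ∸ k ≡ suc (n ∸ suc k)
∸-suc {suc n} (s≤s k≤n) = ℕ.+-∸-assoc 1 k≤n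

timesOneMinusX-∸ : ∀ F {n k} → k ℕ.< n → F (n ∸ k) ≡ timesOneMinusX F (n ∸ k) ℤ.+ F (n ∸ suc k)
timesOneMinusX-∸ F {n} {k} k<n rewrite ∸-suc k<n = regroup (F (suc (n ∸ suc k))) (F (n ∸ suc k))
  where
  regroup : ∀ a b → a ≡ (a ℤ.- b) ℤ.+ b
  regroup = solve-∀

convolutionUpTo : ℕ → (ℕ → ℤ) → ℕ → ℕ → ℤ
convolutionUpTo D F n zero = signedBinom D 0 ℤ.* F n
convolutionUpTo D F n (suc k) = convolutionUpTo D F n k ℤ.+ signedBinom D (suc k) ℤ.* F (n ∸ suc k)

-- timesOneMinusXPow D F n is computed by an accumulator `go` local to a where block of Defs, which
-- cannot be named here.  The underscore is solved by unification at the use in timesOneMinusXPow-unfold,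
-- to `go` (for D, F, a) at k, plus c; the `with … suc n` there makes the arguments distinct variables.
accumulator≡convolutionUpTo : ∀ D F a k (c : ℤ) → _ ≡ convolutionUpTo D F a k ℤ.+ c
timesOneMinusXPow-unfold : ∀ D F n → timesOneMinusXPow D F n ≡ convolutionUpTo D F n n

timesOneMinusXPow-unfold D F zero = refl
timesOneMinusXPow-unfold D F (suc n) with signedBinom D (suc n) ℤ.* F (n ∸ n)
... | lastTerm with suc n
...   | a = accumulator≡convolutionUpTo D F a n lastTerm

accumulator≡convolutionUpTo D F a zero c = refl
accumulator≡convolutionUpTo D F a (suc k) c =
  cong (ℤ._+ c) (accumulator≡convolutionUpTo D F a k (signedBinom D (suc k) ℤ.* F (a ∸ suc k)))

convolutionUpTo-cong : ∀ D {F G} → (∀ j → F j ≡ G j) → ∀ n k →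
  convolutionUpTo D F n k ≡ convolutionUpTo D G n k
convolutionUpTo-cong D F≗G n zero = cong (signedBinom D 0 ℤ.*_) (F≗G n)
convolutionUpTo-cong D F≗G n (suc k) =
  cong₂ ℤ._+_ (convolutionUpTo-cong D F≗G n k) (cong (signedBinom D (suc k) ℤ.*_) (F≗G (n ∸ suc k)))

timesOneMinusXPow-cong : ∀ D {F G} → (∀ j → F j ≡ G j) → ∀ n →
  timesOneMinusXPow D F n ≡ timesOneMinusXPow D G n
timesOneMinusXPow-cong D {F} {G} F≗G n = begin
  timesOneMinusXPow D F n   ≡⟨ timesOneMinusXPow-unfold D F n ⟩
  convolutionUpTo D F n n   ≡⟨ convolutionUpTo-cong D F≗G n n ⟩
  convolutionUpTo D G n n   ≡⟨ timesOneMinusXPow-unfold D G n ⟨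
  timesOneMinusXPow D G n   ∎
  where open ≡-Reasoning

convolutionUpTo-zero : ∀ F n k → convolutionUpTo 0 F n k ≡ F n
convolutionUpTo-zero F n zero = ℤ.*-identityˡ (F n)
convolutionUpTo-zero F n (suc k) = begin
  convolutionUpTo 0 F n k ℤ.+ signedBinom 0 (suc k) ℤ.* F (n ∸ suc k)
    ≡⟨ cong₂ ℤ._+_ (convolutionUpTo-zero F n k) (cong (ℤ._* F (n ∸ suc k)) (ℤ.*-zeroʳ ((ℤ.- + 1) ℤ.^ suc k))) ⟩
  F n ℤ.+ + 0 ℤ.* F (n ∸ suc k)
    ≡⟨ ℤ.+-identityʳ (F n) ⟩
  F n ∎
  where open ≡-Reasoning

timesOneMinusXPow-zero : ∀ F n → timesOneMinusXPow 0 F n ≡ F n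
timesOneMinusXPow-zero F n = trans (timesOneMinusXPow-unfold 0 F n) (convolutionUpTo-zero F n n)

signedBinom-suc : ∀ D k → signedBinom (suc D) (suc k) ≡ signedBinom D (suc k) ℤ.- signedBinom D k
signedBinom-suc D k = begin
  σ ℤ.* + (suc D C suc k)              ≡⟨ cong (λ c → σ ℤ.* + c) (nCk+nC[k+1]≡[n+1]C[k+1] D k) ⟨
  σ ℤ.* + (D C k ℕ.+ D C suc k)        ≡⟨ cong (σ ℤ.*_) (ℤ.pos-+ (D C k) (D C suc k)) ⟩
  σ ℤ.* (+ (D C k) ℤ.+ + (D C suc k))  ≡⟨ regroup ((ℤ.- + 1) ℤ.^ k) (+ (D C k)) (+ (D C suc k)) ⟩
  σ ℤ.* + (D C suc k) ℤ.- (ℤ.- + 1) ℤ.^ k ℤ.* + (D C k) ∎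
  where
  open ≡-Reasoning
  σ = (ℤ.- + 1) ℤ.^ suc k
  regroup : ∀ s a b → ((ℤ.- + 1) ℤ.* s) ℤ.* (a ℤ.+ b) ≡ ((ℤ.- + 1) ℤ.* s) ℤ.* b ℤ.- s ℤ.* a
  regroup = solve-∀

convolutionUpTo-suc : ∀ D F {n} k → k ℕ.< n →
  convolutionUpTo (suc D) F n k ≡ convolutionUpTo D (timesOneMinusX F) n k ℤ.+ signedBinom D k ℤ.* F (n ∸ suc k)
convolutionUpTo-suc D F {n} zero 0<n = begin
  + 1 ℤ.* F n                                            ≡⟨ cong (+ 1 ℤ.*_) (timesOneMinusX-∸ F 0<n) ⟩
  + 1 ℤ.* (timesOneMinusX F n ℤ.+ F (n ∸ 1))             ≡⟨ ℤ.*-distribˡ-+ (+ 1) (timesOneMinusX F n) (F (n ∸ 1)) ⟩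
  + 1 ℤ.* timesOneMinusX F n ℤ.+ + 1 ℤ.* F (n ∸ 1)       ∎
  where open ≡-Reasoning
convolutionUpTo-suc D F {n} (suc k) k<n = begin
  convolutionUpTo (suc D) F n k ℤ.+ signedBinom (suc D) (suc k) ℤ.* F (n ∸ suc k)
    ≡⟨ cong₂ ℤ._+_ (convolutionUpTo-suc D F k (ℕ.<-trans (ℕ.n<1+n k) k<n)) (cong (ℤ._* F (n ∸ suc k)) (signedBinom-suc D k)) ⟩
  (c ℤ.+ s₀ ℤ.* F (n ∸ suc k)) ℤ.+ (s₁ ℤ.- s₀) ℤ.* F (n ∸ suc k)
    ≡⟨ cong (λ a → (c ℤ.+ s₀ ℤ.* a) ℤ.+ (s₁ ℤ.- s₀) ℤ.* a) (timesOneMinusX-∸ F k<n) ⟩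
  (c ℤ.+ s₀ ℤ.* (d ℤ.+ b)) ℤ.+ (s₁ ℤ.- s₀) ℤ.* (d ℤ.+ b)
    ≡⟨ regroup c s₀ s₁ d b ⟩
  (c ℤ.+ s₁ ℤ.* d) ℤ.+ s₁ ℤ.* b ∎
  where
  open ≡-Reasoning
  c = convolutionUpTo D (timesOneMinusX F) n k
  s₀ = signedBinom D k
  s₁ = signedBinom D (suc k)
  d = timesOneMinusX F (n ∸ suc k)
  b = F (n ∸ suc (suc k))
  regroup : ∀ c s₀ s₁ d b → (c ℤ.+ s₀ ℤ.* (d ℤ.+ b)) ℤ.+ (s₁ ℤ.- s₀) ℤ.* (d ℤ.+ b) ≡ (c ℤ.+ s₁ ℤ.* d) ℤ.+ s₁ ℤ.* b
  regroup = solve-∀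

timesOneMinusXPow-suc : ∀ D F n → timesOneMinusXPow (suc D) F n ≡ timesOneMinusXPow D (timesOneMinusX F) n
timesOneMinusXPow-suc D F zero = refl
timesOneMinusXPow-suc D F (suc n) = begin
  timesOneMinusXPow (suc D) F (suc n)
    ≡⟨ timesOneMinusXPow-unfold (suc D) F (suc n) ⟩
  convolutionUpTo (suc D) F (suc n) n ℤ.+ signedBinom (suc D) (suc n) ℤ.* F (n ∸ n)
    ≡⟨ cong₂ ℤ._+_ (convolutionUpTo-suc D F n (ℕ.n<1+n n)) (cong (ℤ._* F (n ∸ n)) (signedBinom-suc D n)) ⟩
  (c ℤ.+ s₀ ℤ.* F (n ∸ n)) ℤ.+ (s₁ ℤ.- s₀) ℤ.* F (n ∸ n)
    ≡⟨ regroup c s₀ s₁ (F (n ∸ n)) ⟩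
  c ℤ.+ s₁ ℤ.* F (n ∸ n)
    ≡⟨ cong (λ j → c ℤ.+ s₁ ℤ.* F j) (ℕ.n∸n≡0 n) ⟩
  c ℤ.+ s₁ ℤ.* timesOneMinusX F 0
    ≡⟨ cong (λ j → c ℤ.+ s₁ ℤ.* timesOneMinusX F j) (ℕ.n∸n≡0 n) ⟨
  convolutionUpTo D (timesOneMinusX F) (suc n) (suc n)
    ≡⟨ timesOneMinusXPow-unfold D (timesOneMinusX F) (suc n) ⟨
  timesOneMinusXPow D (timesOneMinusX F) (suc n) ∎
  where
  open ≡-Reasoning
  c = convolutionUpTo D (timesOneMinusX F) (suc n) n
  s₀ = signedBinom D n
  s₁ = signedBinom D (suc n)
  regroup : ∀ c s₀ s₁ a → (c ℤ.+ s₀ ℤ.* a) ℤ.+ (s₁ ℤ.- s₀) ℤ.* a ≡ c ℤ.+ s₁ ℤ.* a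
  regroup = solve-∀

timesOneMinusXPow-timesOnePlusX : ∀ D F n →
  timesOneMinusXPow D (timesOnePlusX F) n ≡ timesOnePlusX (timesOneMinusXPow D F) n
timesOneMinusXPow-timesOnePlusX zero F n = begin
  timesOneMinusXPow 0 (timesOnePlusX F) n   ≡⟨ timesOneMinusXPow-zero (timesOnePlusX F) n ⟩
  timesOnePlusX F n                         ≡⟨ timesOnePlusX-cong (λ j → timesOneMinusXPow-zero F j) n ⟨
  timesOnePlusX (timesOneMinusXPow 0 F) n   ∎
  where open ≡-Reasoning
timesOneMinusXPow-timesOnePlusX (suc D) F n = begin
  timesOneMinusXPow (suc D) (timesOnePlusX F) n
    ≡⟨ timesOneMinusXPow-suc D (timesOnePlusX F) n ⟩
  timesOneMinusXPow D (timesOneMinusX (timesOnePlusX F)) n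
    ≡⟨ timesOneMinusXPow-cong D (timesOneMinusX-timesOnePlusX F) n ⟩
  timesOneMinusXPow D (timesOnePlusX (timesOneMinusX F)) n
    ≡⟨ timesOneMinusXPow-timesOnePlusX D (timesOneMinusX F) n ⟩
  timesOnePlusX (timesOneMinusXPow D (timesOneMinusX F)) n
    ≡⟨ timesOnePlusX-cong (λ j → timesOneMinusXPow-suc D F j) n ⟨
  timesOnePlusX (timesOneMinusXPow (suc D) F) n ∎
  where open ≡-Reasoning

-- pointCount m k t is the number of lattice points of tΔ in dimension d = k + 1.
pointCount : ℕ → ℕ → ℕ → ℕ
pointCount m zero zero = 1
pointCount m zero (suc t) = m ℕ.+ pointCount m zero t
pointCount m (suc k) zero = pointCount m k zero
pointCount m (suc k) (suc t) = pointCount m k (suc t) ℕ.+ (pointCount m k t ℕ.+ pointCount m (suc k) t)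

pointCount-zero : ∀ m k → pointCount m k 0 ≡ 1
pointCount-zero m zero = refl
pointCount-zero m (suc k) = pointCount-zero m k

ehrSeries-pointCount : ∀ m k n → ehrSeries (pointCount m k) n ≡ + pointCount m k n
ehrSeries-pointCount m k zero = cong +_ (sym (pointCount-zero m k))
ehrSeries-pointCount m k (suc n) = refl

timesOneMinusX-pointCount-suc : ∀ m k n →
  timesOneMinusX (λ t → + pointCount m (suc k) t) n ≡ timesOnePlusX (λ t → + pointCount m k t) n
timesOneMinusX-pointCount-suc m k zero = refl
timesOneMinusX-pointCount-suc m k (suc n) = begin
  + (a ℕ.+ (b ℕ.+ c)) ℤ.- + c          ≡⟨ cong (ℤ._- + c) (trans (ℤ.pos-+ a (b ℕ.+ c)) (cong (λ x → + a ℤ.+ x) (ℤ.pos-+ b c))) ⟩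
  (+ a ℤ.+ (+ b ℤ.+ + c)) ℤ.- + c      ≡⟨ regroup (+ a) (+ b) (+ c) ⟩
  + a ℤ.+ + b                          ∎
  where
  open ≡-Reasoning
  a = pointCount m k (suc n)
  b = pointCount m k n
  c = pointCount m (suc k) n
  regroup : ∀ a b c → (a ℤ.+ (b ℤ.+ c)) ℤ.- c ≡ a ℤ.+ b
  regroup = solve-∀

timesOneMinusX²-pointCount-zero : ∀ m n →
  timesOneMinusX (timesOneMinusX (λ t → + pointCount (suc m) 0 t)) n ≡ targetCoeff 1 (suc m) n
timesOneMinusX²-pointCount-zero m zero = refl
timesOneMinusX²-pointCount-zero m (suc zero) = begin
  (+ (suc m ℕ.+ 1) ℤ.- + 1) ℤ.- + 1    ≡⟨ cong (λ a → (a ℤ.- + 1) ℤ.- + 1) (ℤ.pos-+ (suc m) 1) ⟩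
  (+ suc m ℤ.+ + 1 ℤ.- + 1) ℤ.- + 1    ≡⟨ cong (λ a → (a ℤ.+ + 1 ℤ.- + 1) ℤ.- + 1) (ℤ.pos-+ 1 m) ⟩
  (+ 1 ℤ.+ + m ℤ.+ + 1 ℤ.- + 1) ℤ.- + 1 ≡⟨ regroup (+ m) ⟩
  + 0 ℤ.+ + m ℤ.* + 1                  ∎
  where
  open ≡-Reasoning
  regroup : ∀ a → (+ 1 ℤ.+ a ℤ.+ + 1 ℤ.- + 1) ℤ.- + 1 ≡ + 0 ℤ.+ a ℤ.* + 1
  regroup = solve-∀
timesOneMinusX²-pointCount-zero m (suc (suc n)) = begin
  (+ (M ℕ.+ (M ℕ.+ c)) ℤ.- + (M ℕ.+ c)) ℤ.- (+ (M ℕ.+ c) ℤ.- + c)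
    ≡⟨ cong₂ (λ a b → (a ℤ.- b) ℤ.- (b ℤ.- + c)) (trans (ℤ.pos-+ M (M ℕ.+ c)) (cong (λ x → + M ℤ.+ x) (ℤ.pos-+ M c))) (ℤ.pos-+ M c) ⟩
  (+ M ℤ.+ (+ M ℤ.+ + c) ℤ.- (+ M ℤ.+ + c)) ℤ.- ((+ M ℤ.+ + c) ℤ.- + c)
    ≡⟨ regroup (+ M) (+ c) (+ m) ⟩
  + 0 ℤ.+ + m ℤ.* + 0 ∎
  where
  open ≡-Reasoning
  M = suc m
  c = pointCount M 0 n
  regroup : ∀ a c b → (a ℤ.+ (a ℤ.+ c) ℤ.- (a ℤ.+ c)) ℤ.- ((a ℤ.+ c) ℤ.- c) ≡ + 0 ℤ.+ b ℤ.* + 0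
  regroup = solve-∀

targetCoeff-suc : ∀ m k n → targetCoeff (suc (suc k)) m n ≡ timesOnePlusX (targetCoeff (suc k) m) n
targetCoeff-suc m k zero = refl
targetCoeff-suc m k (suc zero) = begin
  + (suc k C 1) ℤ.+ M ℤ.* + (suc k C 0)         ≡⟨ cong (λ c → + c ℤ.+ M ℤ.* + 1) (nCk+nC[k+1]≡[n+1]C[k+1] k 0) ⟨
  + (k C 0 ℕ.+ k C 1) ℤ.+ M ℤ.* + 1             ≡⟨ cong (ℤ._+ M ℤ.* + 1) (ℤ.pos-+ (k C 0) (k C 1)) ⟩
  (+ 1 ℤ.+ + (k C 1)) ℤ.+ M ℤ.* + 1             ≡⟨ regroup (+ (k C 1)) M ⟩
  (+ (k C 1) ℤ.+ M ℤ.* + (k C 0)) ℤ.+ + (k C 0) ∎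
  where
  open ≡-Reasoning
  M = + (m ∸ 1)
  regroup : ∀ a M → (+ 1 ℤ.+ a) ℤ.+ M ℤ.* + 1 ≡ (a ℤ.+ M ℤ.* + 1) ℤ.+ + 1
  regroup = solve-∀
targetCoeff-suc m k (suc (suc n)) = begin
  + (suc k C suc (suc n)) ℤ.+ M ℤ.* + (suc k C suc n)
    ≡⟨ cong₂ (λ c c′ → + c ℤ.+ M ℤ.* + c′) (nCk+nC[k+1]≡[n+1]C[k+1] k (suc n)) (nCk+nC[k+1]≡[n+1]C[k+1] k n) ⟨
  + (b ℕ.+ c) ℤ.+ M ℤ.* + (a ℕ.+ b)
    ≡⟨ cong₂ (λ u v → u ℤ.+ M ℤ.* v) (ℤ.pos-+ b c) (ℤ.pos-+ a b) ⟩
  (+ b ℤ.+ + c) ℤ.+ M ℤ.* (+ a ℤ.+ + b)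
    ≡⟨ regroup (+ a) (+ b) (+ c) M ⟩
  (+ c ℤ.+ M ℤ.* + b) ℤ.+ (+ b ℤ.+ M ℤ.* + a) ∎
  where
  open ≡-Reasoning
  M = + (m ∸ 1)
  a = k C n
  b = k C suc n
  c = k C suc (suc n)
  regroup : ∀ a b c M → (b ℤ.+ c) ℤ.+ M ℤ.* (a ℤ.+ b) ≡ (c ℤ.+ M ℤ.* b) ℤ.+ (b ℤ.+ M ℤ.* a)
  regroup = solve-∀

timesOneMinusXPow-pointCount : ∀ m k n →
  timesOneMinusXPow (suc (suc k)) (λ t → + pointCount (suc m) k t) n ≡ targetCoeff (suc k) (suc m) n
timesOneMinusXPow-pointCount m zero n = begin
  timesOneMinusXPow 2 P₀ n                                   ≡⟨ timesOneMinusXPow-suc 1 P₀ n ⟩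
  timesOneMinusXPow 1 (timesOneMinusX P₀) n                  ≡⟨ timesOneMinusXPow-suc 0 (timesOneMinusX P₀) n ⟩
  timesOneMinusXPow 0 (timesOneMinusX (timesOneMinusX P₀)) n ≡⟨ timesOneMinusXPow-zero _ n ⟩
  timesOneMinusX (timesOneMinusX P₀) n                       ≡⟨ timesOneMinusX²-pointCount-zero m n ⟩
  targetCoeff 1 (suc m) n                                    ∎
  where
  open ≡-Reasoning
  P₀ = λ t → + pointCount (suc m) 0 t
timesOneMinusXPow-pointCount m (suc k) n = begin
  timesOneMinusXPow (3 ℕ.+ k) Pₖ₊₁ n
    ≡⟨ timesOneMinusXPow-suc (2 ℕ.+ k) Pₖ₊₁ n ⟩
  timesOneMinusXPow (2 ℕ.+ k) (timesOneMinusX Pₖ₊₁) n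
    ≡⟨ timesOneMinusXPow-cong (2 ℕ.+ k) (timesOneMinusX-pointCount-suc (suc m) k) n ⟩
  timesOneMinusXPow (2 ℕ.+ k) (timesOnePlusX Pₖ) n
    ≡⟨ timesOneMinusXPow-timesOnePlusX (2 ℕ.+ k) Pₖ n ⟩
  timesOnePlusX (timesOneMinusXPow (2 ℕ.+ k) Pₖ) n
    ≡⟨ timesOnePlusX-cong (timesOneMinusXPow-pointCount m k) n ⟩
  timesOnePlusX (targetCoeff (suc k) (suc m)) n
    ≡⟨ targetCoeff-suc (suc m) k n ⟨
  targetCoeff (2 ℕ.+ k) (suc m) n ∎
  where
  open ≡-Reasoning
  Pₖ = λ t → + pointCount (suc m) k t
  Pₖ₊₁ = λ t → + pointCount (suc m) (suc k) t

Enumerates : {A : Set} → (A → Set) → List A → Set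
Enumerates P xs = Unique xs × (∀ a → P a ⇔ a ∈ xs)

Image : {A B : Set} → (A → B) → (A → Set) → B → Set
Image f P b = ∃ λ a → P a × b ≡ f a

enumerates-⇔ : ∀ {A : Set} {P Q : A → Set} {xs} → (∀ a → P a ⇔ Q a) → Enumerates P xs → Enumerates Q xs
enumerates-⇔ P⇔Q (unique , P⇔∈) = unique , λ a → ⇔-trans (⇔-sym (P⇔Q a)) (P⇔∈ a)

enumerates-singleton : ∀ {A : Set} (x : A) → Enumerates (_≡ x) [ x ]
enumerates-singleton x = [] ∷ [] , λ a → mk⇔ (λ { refl → here refl }) (λ { (here a≡x) → a≡x })

enumerates-allFin : ∀ n → Enumerates (λ (_ : Fin n) → ⊤) (allFin n)
enumerates-allFin n = Unique.allFin⁺ n , λ i → mk⇔ (λ _ → ∈-allFin i) (λ _ → tt)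

enumerates-++ : ∀ {A : Set} {P Q : A → Set} {xs ys} → (∀ a → P a → ¬ Q a) →
  Enumerates P xs → Enumerates Q ys → Enumerates (λ a → P a ⊎ Q a) (xs ++ ys)
enumerates-++ {P = P} {Q} {xs} {ys} disjoint (uniqueˣ , P⇔∈xs) (uniqueʸ , Q⇔∈ys) =
  Unique.++⁺ uniqueˣ uniqueʸ apart , λ a → mk⇔ (into a) (outof a)
  where
  apart : ∀ {a} → ¬ (a ∈ xs × a ∈ ys)
  apart {a} (a∈xs , a∈ys) = disjoint a (Equivalence.from (P⇔∈xs a) a∈xs) (Equivalence.from (Q⇔∈ys a) a∈ys)
  into : ∀ a → P a ⊎ Q a → a ∈ xs ++ ys
  into a (inj₁ Pa) = ∈-++⁺ˡ (Equivalence.to (P⇔∈xs a) Pa)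
  into a (inj₂ Qa) = ∈-++⁺ʳ xs (Equivalence.to (Q⇔∈ys a) Qa)
  outof : ∀ a → a ∈ xs ++ ys → P a ⊎ Q a
  outof a a∈ with ∈-++⁻ xs a∈
  ... | inj₁ a∈xs = inj₁ (Equivalence.from (P⇔∈xs a) a∈xs)
  ... | inj₂ a∈ys = inj₂ (Equivalence.from (Q⇔∈ys a) a∈ys)

enumerates-map : ∀ {A B : Set} {P : A → Set} {xs} (f : A → B) → (∀ {a a′} → f a ≡ f a′ → a ≡ a′) →
  Enumerates P xs → Enumerates (Image f P) (map f xs)
enumerates-map {P = P} {xs} f f-injective (unique , P⇔∈) = Unique.map⁺ f-injective unique , λ b → mk⇔ into (outof b)
  where
  into : ∀ {b} → Image f P b → b ∈ map f xs
  into (a , Pa , refl) = ∈-map⁺ f (Equivalence.to (P⇔∈ a) Pa)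
  outof : ∀ b → b ∈ map f xs → Image f P b
  outof b b∈ with ∈-map⁻ f b∈
  ... | a , a∈xs , b≡fa = a , Equivalence.from (P⇔∈ a) a∈xs , b≡fa

b-a<0 : ∀ {a b} → b ℕ.< a → + b ℤ.- + a ℤ.< 0ℤ
b-a<0 {a} {b} b<a = begin-strict
  + b ℤ.- + a    <⟨ ℤ.+-monoˡ-< (ℤ.- + a) (ℤ.+<+ b<a) ⟩
  + a ℤ.- + a    ≡⟨ ℤ.+-inverseʳ (+ a) ⟩
  0ℤ             ∎
  where open ℤ.≤-Reasoning

nonNeg-cancel : ∀ {a b} X → b ℕ.< a → 0ℤ ℤ.≤ + a ℤ.* X ℤ.+ + b → 0ℤ ℤ.≤ X
nonNeg-cancel (+ n) _ _ = ℤ.+≤+ z≤n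
nonNeg-cancel {a} {b} -[1+ n ] b<a 0≤aX+b = contradiction 0≤aX+b (ℤ.<⇒≱ aX+b<0)
  where
  open ℤ.≤-Reasoning
  regroup : ∀ a b → a ℤ.* -[1+ 0 ] ℤ.+ b ≡ b ℤ.- a
  regroup = solve-∀
  aX+b<0 : + a ℤ.* -[1+ n ] ℤ.+ + b ℤ.< 0ℤ
  aX+b<0 = begin-strict
    + a ℤ.* -[1+ n ] ℤ.+ + b    ≤⟨ ℤ.+-monoˡ-≤ (+ b) (ℤ.*-monoˡ-≤-nonNeg (+ a) (ℤ.-≤- z≤n)) ⟩
    + a ℤ.* -[1+ 0 ] ℤ.+ + b    ≡⟨ regroup (+ a) (+ b) ⟩
    + b ℤ.- + a                 <⟨ b-a<0 b<a ⟩
    0ℤ                          ∎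

0≤a*X+b : ∀ a b {X} → 0ℤ ℤ.≤ X → 0ℤ ℤ.≤ + a ℤ.* X ℤ.+ + b
0≤a*X+b a b {X} 0≤X = begin
  0ℤ                  ≡⟨ ℤ.*-zeroʳ (+ a) ⟨
  + a ℤ.* 0ℤ          ≤⟨ ℤ.*-monoˡ-≤-nonNeg (+ a) 0≤X ⟩
  + a ℤ.* X           ≤⟨ ℤ.i≤i+j (+ a ℤ.* X) (+ b) ⟩
  + a ℤ.* X ℤ.+ + b   ∎
  where open ℤ.≤-Reasoning

nonNeg⇔2^k* : ∀ k a → 0ℤ ℤ.≤ a ⇔ 0ℤ ℤ.≤ + 2 ^ k ℤ.* a
nonNeg⇔2^k* k a = mk⇔
  (λ 0≤a → subst (ℤ._≤ + 2 ^ k ℤ.* a) (ℤ.*-zeroʳ (+ 2 ^ k)) (ℤ.*-monoˡ-≤-nonNeg (+ 2 ^ k) 0≤a))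
  (λ 0≤2^ka → ℤ.*-cancelˡ-≤-pos 0ℤ a (+ 2 ^ k) {{ℤ.positive (ℤ.+<+ (ℕ.m^n>0 2 k))}}
                (subst (ℤ._≤ + 2 ^ k ℤ.* a) (sym (ℤ.*-zeroʳ (+ 2 ^ k))) 0≤2^ka))

zero-or-suc : ∀ z → 0ℤ ℤ.≤ z → z ≡ 0ℤ ⊎ ∃ λ n → z ≡ + suc n
zero-or-suc (+ zero) _ = inj₁ refl
zero-or-suc (+ suc n) _ = inj₂ (n , refl)

parity : ∀ V → ∃ λ β → ∃ λ v → β ℕ.< 2 × V ≡ β ℕ.+ 2 ℕ.* v
parity V = V ℕ.% 2 , V ℕ./ 2 , m%n<n V 2 , trans (m≡m%n+[m/n]*n V 2) (cong (V ℕ.% 2 ℕ.+_) (ℕ.*-comm (V ℕ./ 2) 2))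

∑-powers-of-two : ∀ n → ℤΣ.sum (λ (i : Fin n) → + 2 ^ toℕ i) ≡ + 2 ^ n ℤ.- + 1
∑-powers-of-two zero = refl
∑-powers-of-two (suc n) = begin
  + 1 ℤ.+ ℤΣ.sum {n} (λ i → + (2 ℕ.* 2 ^ toℕ i))       ≡⟨ cong (ℤ._+_ (+ 1)) (ℤΣ.sum-cong-≗ {n} (λ i → ℤ.pos-* 2 (2 ^ toℕ i))) ⟩
  + 1 ℤ.+ ℤΣ.sum {n} (λ i → + 2 ℤ.* + 2 ^ toℕ i)       ≡⟨ cong (ℤ._+_ (+ 1)) (ℤΣ.*-distribˡ-sum {n} (+ 2) (λ i → + 2 ^ toℕ i)) ⟨
  + 1 ℤ.+ + 2 ℤ.* ℤΣ.sum {n} (λ i → + 2 ^ toℕ i)       ≡⟨ cong (λ s → + 1 ℤ.+ + 2 ℤ.* s) (∑-powers-of-two n) ⟩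
  + 1 ℤ.+ + 2 ℤ.* (+ 2 ^ n ℤ.- + 1)                ≡⟨ regroup (+ 2 ^ n) ⟩
  + 2 ℤ.* + 2 ^ n ℤ.- + 1                          ≡⟨ cong (ℤ._- + 1) (ℤ.pos-* 2 (2 ^ n)) ⟨
  + (2 ℕ.* 2 ^ n) ℤ.- + 1                          ∎
  where
  open ≡-Reasoning
  regroup : ∀ p → + 1 ℤ.+ + 2 ℤ.* (p ℤ.- + 1) ≡ + 2 ℤ.* p ℤ.- + 1
  regroup = solve-∀

2^[n∸j]≡2*2^opposite : ∀ {n} (j : Fin n) → 2 ^ (n ∸ toℕ j) ≡ 2 ℕ.* 2 ^ toℕ (opposite j)
2^[n∸j]≡2*2^opposite j = trans (cong (2 ^_) (∸-suc (Fin.toℕ<n j))) (cong (λ a → 2 ℕ.* 2 ^ a) (sym (Fin.opposite-prop j)))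

module _ {A : Set} where

  lookup-∷ʳ-inject₁ : ∀ {n} (xs : Vec A n) x i → lookup (xs ∷ʳ x) (inject₁ i) ≡ lookup xs i
  lookup-∷ʳ-inject₁ (y ∷ xs) x Fin.zero = refl
  lookup-∷ʳ-inject₁ (y ∷ xs) x (Fin.suc i) = lookup-∷ʳ-inject₁ xs x i

  lookup-∷ʳ-last : ∀ {n} (xs : Vec A n) x → lookup (xs ∷ʳ x) (fromℕ n) ≡ x
  lookup-∷ʳ-last [] x = refl
  lookup-∷ʳ-last (y ∷ xs) x = lookup-∷ʳ-last xs x

  lookup-reverse-opposite : ∀ {n} (xs : Vec A n) i → lookup (reverse xs) (opposite i) ≡ lookup xs i
  lookup-reverse-opposite {suc n} (x ∷ xs) Fin.zero =
    trans (cong (λ ys → lookup ys (fromℕ n)) (Vec.reverse-∷ x xs)) (lookup-∷ʳ-last (reverse xs) x)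
  lookup-reverse-opposite {suc n} (x ∷ xs) (Fin.suc i) = begin
    lookup (reverse (x ∷ xs)) (inject₁ (opposite i))   ≡⟨ cong (λ ys → lookup ys (inject₁ (opposite i))) (Vec.reverse-∷ x xs) ⟩
    lookup (reverse xs ∷ʳ x) (inject₁ (opposite i))    ≡⟨ lookup-∷ʳ-inject₁ (reverse xs) x (opposite i) ⟩
    lookup (reverse xs) (opposite i)                   ≡⟨ lookup-reverse-opposite xs i ⟩
    lookup xs i                                        ∎
    where open ≡-Reasoning

  lookup-reverse : ∀ {n} (xs : Vec A n) i → lookup (reverse xs) i ≡ lookup xs (opposite i)
  lookup-reverse xs i =
    trans (cong (lookup (reverse xs)) (sym (Fin.opposite-involutive i))) (lookup-reverse-opposite xs (opposite i))

sum-∷ʳ : ∀ {n} (xs : Vec ℤ n) x → ℤΣ.sum (lookup (xs ∷ʳ x)) ≡ ℤΣ.sum (lookup xs) ℤ.+ x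
sum-∷ʳ xs x =
  trans (ℤΣ.sum-init-last (lookup (xs ∷ʳ x))) (cong₂ ℤ._+_ (ℤΣ.sum-cong-≗ (lookup-∷ʳ-inject₁ xs x)) (lookup-∷ʳ-last xs x))

sum-reverse : ∀ {n} (xs : Vec ℤ n) → ℤΣ.sum (lookup (reverse xs)) ≡ ℤΣ.sum (lookup xs)
sum-reverse [] = refl
sum-reverse (x ∷ xs) = begin
  ℤΣ.sum (lookup (reverse (x ∷ xs)))      ≡⟨ cong (λ ys → ℤΣ.sum (lookup ys)) (Vec.reverse-∷ x xs) ⟩
  ℤΣ.sum (lookup (reverse xs ∷ʳ x))       ≡⟨ sum-∷ʳ (reverse xs) x ⟩
  ℤΣ.sum (lookup (reverse xs)) ℤ.+ x      ≡⟨ cong (ℤ._+ x) (sum-reverse xs) ⟩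
  ℤΣ.sum (lookup xs) ℤ.+ x                ≡⟨ ℤ.+-comm (ℤΣ.sum (lookup xs)) x ⟩
  x ℤ.+ ℤΣ.sum (lookup xs)                ∎
  where open ≡-Reasoning

data InitOrLast : ∀ {n} → Fin (suc n) → Set where
  init : ∀ {n} (i : Fin n) → InitOrLast (inject₁ i)
  last : ∀ {n} → InitOrLast (fromℕ n)

initOrLast : ∀ {n} (k : Fin (suc n)) → InitOrLast k
initOrLast {zero} Fin.zero = last
initOrLast {suc n} Fin.zero = init Fin.zero
initOrLast {suc n} (Fin.suc k) with initOrLast k
... | init i = init (Fin.suc i)
... | last = last

BoundedBelow : ∀ {k} → ℕ → ℕ → Vec ℤ k → Set
BoundedBelow e v [] = ⊤
BoundedBelow e v (x ∷ r) = 0ℤ ℤ.≤ + e ℤ.* x ℤ.+ + v × BoundedBelow (2 ℕ.* e) v r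

pos-+-2* : ∀ β v → + (β ℕ.+ 2 ℕ.* v) ≡ + β ℤ.+ + 2 ℤ.* + v
pos-+-2* β v = trans (ℤ.pos-+ β (2 ℕ.* v)) (cong (λ z → + β ℤ.+ z) (ℤ.pos-* 2 v))

doubled : ∀ e x β v → + (2 ℕ.* e) ℤ.* x ℤ.+ + (β ℕ.+ 2 ℕ.* v) ≡ + 2 ℤ.* (+ e ℤ.* x ℤ.+ + v) ℤ.+ + β
doubled e x β v = trans (cong₂ (λ a b → a ℤ.* x ℤ.+ b) (ℤ.pos-* 2 e) (pos-+-2* β v)) (regroup (+ e) x (+ β) (+ v))
  where
  regroup : ∀ e x β v → + 2 ℤ.* e ℤ.* x ℤ.+ (β ℤ.+ + 2 ℤ.* v) ≡ + 2 ℤ.* (e ℤ.* x ℤ.+ v) ℤ.+ β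
  regroup = solve-∀

halving : ∀ x β v → + 2 ℤ.* x ℤ.+ + (β ℕ.+ 2 ℕ.* v) ≡ + 2 ℤ.* (x ℤ.+ + v) ℤ.+ + β
halving x β v = trans (cong (λ z → + 2 ℤ.* x ℤ.+ z) (pos-+-2* β v)) (regroup x (+ β) (+ v))
  where
  regroup : ∀ x β v → + 2 ℤ.* x ℤ.+ (β ℤ.+ + 2 ℤ.* v) ≡ + 2 ℤ.* (x ℤ.+ v) ℤ.+ β
  regroup = solve-∀

head-halve : ∀ x β v → β ℕ.< 2 → 0ℤ ℤ.≤ + 2 ℤ.* x ℤ.+ + (β ℕ.+ 2 ℕ.* v) → 0ℤ ℤ.≤ x ℤ.+ + v
head-halve x β v β<2 0≤ = nonNeg-cancel _ β<2 (subst (0ℤ ℤ.≤_) (halving x β v) 0≤)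

boundedBelow-double : ∀ {k} {e v} β (r : Vec ℤ k) → BoundedBelow e v r → BoundedBelow (2 ℕ.* e) (β ℕ.+ 2 ℕ.* v) r
boundedBelow-double β [] tt = tt
boundedBelow-double {e = e} {v} β (x ∷ r) (0≤ex+v , bounded) =
  subst (0ℤ ℤ.≤_) (sym (doubled e x β v)) (0≤a*X+b 2 β 0≤ex+v) , boundedBelow-double β r bounded

boundedBelow-halve : ∀ {k} {e v β} (r : Vec ℤ k) → β ℕ.< 2 → BoundedBelow (2 ℕ.* e) (β ℕ.+ 2 ℕ.* v) r → BoundedBelow e v r
boundedBelow-halve [] β<2 tt = tt
boundedBelow-halve {e = e} {v} {β} (x ∷ r) β<2 (0≤ , bounded) =
  nonNeg-cancel _ β<2 (subst (0ℤ ℤ.≤_) (doubled e x β v) 0≤) , boundedBelow-halve r β<2 bounded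

boundedBelow-sum : ∀ {k} e v (r : Vec ℤ k) → BoundedBelow (2 ℕ.* e) v r → 0ℤ ℤ.≤ + e ℤ.* ℤΣ.sum (lookup r) ℤ.+ + v
boundedBelow-sum e v [] tt = subst (λ z → 0ℤ ℤ.≤ z ℤ.+ + v) (sym (ℤ.*-zeroʳ (+ e))) (ℤ.+≤+ z≤n)
boundedBelow-sum e v (x ∷ r) (0≤2ex+v , bounded) =
  nonNeg-cancel {2} {0} _ (s≤s z≤n) (subst (0ℤ ℤ.≤_) eq (ℤ.+-mono-≤ 0≤2ex+v (boundedBelow-sum (2 ℕ.* e) v r bounded)))
  where
  s = ℤΣ.sum (lookup r)
  regroup : ∀ e x s v → (+ 2 ℤ.* e ℤ.* x ℤ.+ v) ℤ.+ (+ 2 ℤ.* e ℤ.* s ℤ.+ v) ≡ + 2 ℤ.* (e ℤ.* (x ℤ.+ s) ℤ.+ v) ℤ.+ + 0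
  regroup = solve-∀
  eq : (+ (2 ℕ.* e) ℤ.* x ℤ.+ + v) ℤ.+ (+ (2 ℕ.* e) ℤ.* s ℤ.+ + v) ≡ + 2 ℤ.* (+ e ℤ.* (x ℤ.+ s) ℤ.+ + v) ℤ.+ + 0
  eq = trans (cong (λ c → (c ℤ.* x ℤ.+ + v) ℤ.+ (c ℤ.* s ℤ.+ + v)) (ℤ.pos-* 2 e)) (regroup (+ e) x s (+ v))

boundedBelow⇔ : ∀ {k} e v (r : Vec ℤ k) →
  BoundedBelow e v r ⇔ (∀ i → 0ℤ ℤ.≤ + (e ℕ.* 2 ^ toℕ i) ℤ.* lookup r i ℤ.+ + v)
boundedBelow⇔ e v [] = mk⇔ (λ _ ()) (λ _ → tt)
boundedBelow⇔ e v (x ∷ r) = mk⇔ to from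
  where
  Bound : ℕ → ℤ → Set
  Bound c y = 0ℤ ℤ.≤ + c ℤ.* y ℤ.+ + v
  coefficient : ∀ i → 2 ℕ.* e ℕ.* 2 ^ i ≡ e ℕ.* 2 ^ suc i
  coefficient i = trans (cong (ℕ._* 2 ^ i) (ℕ.*-comm 2 e)) (ℕ.*-assoc e 2 (2 ^ i))
  to : BoundedBelow e v (x ∷ r) → ∀ i → Bound (e ℕ.* 2 ^ toℕ i) (lookup (x ∷ r) i)
  to (0≤ex+v , _) Fin.zero = subst (λ c → Bound c x) (sym (ℕ.*-identityʳ e)) 0≤ex+v
  to (_ , bounded) (Fin.suc i) =
    subst (λ c → Bound c (lookup r i)) (coefficient (toℕ i)) (Equivalence.to (boundedBelow⇔ (2 ℕ.* e) v r) bounded i)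
  from : (∀ i → Bound (e ℕ.* 2 ^ toℕ i) (lookup (x ∷ r) i)) → BoundedBelow e v (x ∷ r)
  from bounds =
    subst (λ c → Bound c x) (ℕ.*-identityʳ e) (bounds Fin.zero) ,
    Equivalence.from (boundedBelow⇔ (2 ℕ.* e) v r)
      (λ i → subst (λ c → Bound c (lookup r i)) (sym (coefficient (toℕ i))) (bounds (Fin.suc i)))

-- Codes of lattice points

module Codes (m-1 : ℕ) where

  m : ℕ
  m = suc m-1

  -- (r , v , w) stands for the lattice point reverse r ∷ʳ (m·v + w) (see toPoint): r starts with the
  -- coordinate whose facet coefficient is smallest.
  Code : ℕ → Set
  Code k = Vec ℤ k × ℕ × Fin m

  weight : ∀ {k} → Code k → ℤ
  weight (r , v , w) = + m ℤ.* (ℤΣ.sum (lookup r) ℤ.+ + v) ℤ.+ + toℕ w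

  Admissible : ∀ k → ℕ → Code k → Set
  Admissible k t (r , v , w) = BoundedBelow 2 v r × weight (r , v , w) ℤ.≤ + m ℤ.* + t

  base : Fin m → Code 0
  base w = [] , 0 , w

  raise₀ : Code 0 → Code 0
  raise₀ (r , v , w) = r , suc v , w

  extend : ∀ {k} → ℕ → Code k → Code (suc k)
  extend β (r , v , w) = ℤ.- + v ∷ r , β ℕ.+ 2 ℕ.* v , w

  raise : ∀ {k} → Code (suc k) → Code (suc k)
  raise (x ∷ r , v , w) = ℤ.suc x ∷ r , v , w

  weight-nonNeg : ∀ {k} r v w → BoundedBelow {k} 2 v r → 0ℤ ℤ.≤ weight (r , v , w)
  weight-nonNeg r v w bounded =
    0≤a*X+b m (toℕ w) (subst (λ s → 0ℤ ℤ.≤ s ℤ.+ + v) (ℤ.*-identityˡ (ℤΣ.sum (lookup r))) (boundedBelow-sum 1 v r bounded))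

  level-+ : ∀ β t → + m ℤ.* + (β ℕ.+ t) ≡ + m ℤ.* + t ℤ.+ + m ℤ.* + β
  level-+ β t = trans (cong (+ m ℤ.*_) (ℤ.pos-+ β t)) (regroup (+ m) (+ β) (+ t))
    where
    regroup : ∀ m β t → m ℤ.* (β ℤ.+ t) ≡ m ℤ.* t ℤ.+ m ℤ.* β
    regroup = solve-∀

  level-suc : ∀ t → + m ℤ.* + suc t ≡ + m ℤ.* + t ℤ.+ + m
  level-suc t = trans (level-+ 1 t) (cong (λ z → + m ℤ.* + t ℤ.+ z) (ℤ.*-identityʳ (+ m)))

  level-cancel : ∀ {W} t → W ℤ.+ + m ℤ.≤ + m ℤ.* + suc t → W ℤ.≤ + m ℤ.* + t
  level-cancel {W} t W+m≤ = begin
    W                                       ≡⟨ regroup W (+ m) ⟨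
    W ℤ.+ + m ℤ.- + m                       ≤⟨ ℤ.+-monoˡ-≤ (ℤ.- + m) W+m≤ ⟩
    + m ℤ.* + suc t ℤ.- + m                 ≡⟨ cong (ℤ._- + m) (level-suc t) ⟩
    + m ℤ.* + t ℤ.+ + m ℤ.- + m             ≡⟨ regroup (+ m ℤ.* + t) (+ m) ⟩
    + m ℤ.* + t                             ∎
    where
    open ℤ.≤-Reasoning
    regroup : ∀ a b → a ℤ.+ b ℤ.- b ≡ a
    regroup = solve-∀

  level-pred : ∀ {W} t → 0ℤ ℤ.≤ W → W ℤ.+ + m ℤ.≤ + m ℤ.* + t → ∃ λ t′ → t ≡ suc t′ × W ℤ.≤ + m ℤ.* + t′
  level-pred {W} zero 0≤W W+m≤0 = contradiction W+m≤0 (ℤ.<⇒≱ 0<W+m)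
    where
    open ℤ.≤-Reasoning
    0<W+m : + m ℤ.* + 0 ℤ.< W ℤ.+ + m
    0<W+m = begin-strict
      + m ℤ.* + 0   ≡⟨ ℤ.*-zeroʳ (+ m) ⟩
      0ℤ            <⟨ ℤ.+<+ (s≤s z≤n) ⟩
      + m           ≤⟨ ℤ.+-monoˡ-≤ (+ m) 0≤W ⟩
      W ℤ.+ + m     ∎
  level-pred (suc t) 0≤W W+m≤ = t , refl , level-cancel t W+m≤

  weight-extend : ∀ {k} β (c : Code k) → weight (extend β c) ≡ weight c ℤ.+ + m ℤ.* + β
  weight-extend β (r , v , w) =
    trans (cong (λ V → + m ℤ.* ((ℤ.- + v ℤ.+ ℤΣ.sum (lookup r)) ℤ.+ V) ℤ.+ + toℕ w) (pos-+-2* β v))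
          (regroup (+ m) (+ v) (ℤΣ.sum (lookup r)) (+ β) (+ toℕ w))
    where
    regroup : ∀ m v s β w → m ℤ.* ((ℤ.- v ℤ.+ s) ℤ.+ (β ℤ.+ + 2 ℤ.* v)) ℤ.+ w ≡ (m ℤ.* (s ℤ.+ v) ℤ.+ w) ℤ.+ m ℤ.* β
    regroup = solve-∀

  weight-raise : ∀ {k} (c : Code (suc k)) → weight (raise c) ≡ weight c ℤ.+ + m
  weight-raise (x ∷ r , v , w) = regroup (+ m) x (ℤΣ.sum (lookup r)) (+ v) (+ toℕ w)
    where
    regroup : ∀ m x s v w → m ℤ.* ((+ 1 ℤ.+ x ℤ.+ s) ℤ.+ v) ℤ.+ w ≡ (m ℤ.* ((x ℤ.+ s) ℤ.+ v) ℤ.+ w) ℤ.+ m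
    regroup = solve-∀

  weight-raise₀ : (c : Code 0) → weight (raise₀ c) ≡ weight c ℤ.+ + m
  weight-raise₀ ([] , v , w) =
    trans (cong (λ V → + m ℤ.* (0ℤ ℤ.+ V) ℤ.+ + toℕ w) (ℤ.pos-+ 1 v)) (regroup (+ m) (+ v) (+ toℕ w))
    where
    regroup : ∀ m v w → m ℤ.* (0ℤ ℤ.+ (+ 1 ℤ.+ v)) ℤ.+ w ≡ (m ℤ.* (0ℤ ℤ.+ v) ℤ.+ w) ℤ.+ m
    regroup = solve-∀

  weight₀ : ∀ v w → weight ([] , v , w) ≡ + (m ℕ.* v ℕ.+ toℕ w)
  weight₀ v w = cong (ℤ._+ + toℕ w) (sym (ℤ.pos-* m v))

  level₀ : ∀ {t} v w → weight ([] , v , w) ℤ.≤ + m ℤ.* + t → m ℕ.* v ℕ.+ toℕ w ℕ.≤ m ℕ.* t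
  level₀ {t} v w weight≤ = ℤ.drop‿+≤+ (subst₂ ℤ._≤_ (weight₀ v w) (sym (ℤ.pos-* m t)) weight≤)

  admissible-extend⁺ : ∀ {k t} β (c : Code k) → Admissible k t c → Admissible (suc k) (β ℕ.+ t) (extend β c)
  admissible-extend⁺ {t = t} β c@(r , v , w) (bounded , weight≤) = (head , boundedBelow-double β r bounded) , weight≤′
    where
    open ℤ.≤-Reasoning
    regroup : ∀ v β → + 2 ℤ.* (ℤ.- v) ℤ.+ (β ℤ.+ + 2 ℤ.* v) ≡ β
    regroup = solve-∀
    head : 0ℤ ℤ.≤ + 2 ℤ.* (ℤ.- + v) ℤ.+ + (β ℕ.+ 2 ℕ.* v)
    head = subst (0ℤ ℤ.≤_) (sym (trans (cong (λ z → + 2 ℤ.* (ℤ.- + v) ℤ.+ z) (pos-+-2* β v)) (regroup (+ v) (+ β))))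
                 (ℤ.+≤+ z≤n)
    weight≤′ : weight (extend β c) ℤ.≤ + m ℤ.* + (β ℕ.+ t)
    weight≤′ = begin
      weight (extend β c)              ≡⟨ weight-extend β c ⟩
      weight c ℤ.+ + m ℤ.* + β         ≤⟨ ℤ.+-monoˡ-≤ (+ m ℤ.* + β) weight≤ ⟩
      + m ℤ.* + t ℤ.+ + m ℤ.* + β      ≡⟨ level-+ β t ⟨
      + m ℤ.* + (β ℕ.+ t)              ∎

  admissible-raise⁺ : ∀ {k t} (c : Code (suc k)) → Admissible (suc k) t c → Admissible (suc k) (suc t) (raise c)
  admissible-raise⁺ {t = t} c@(x ∷ r , v , w) ((0≤2x+v , bounded) , weight≤) = (head , bounded) , weight≤′
    where
    open ℤ.≤-Reasoning
    regroup : ∀ x v → + 2 ℤ.* (+ 1 ℤ.+ x) ℤ.+ v ≡ (+ 2 ℤ.* x ℤ.+ v) ℤ.+ + 2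
    regroup = solve-∀
    head : 0ℤ ℤ.≤ + 2 ℤ.* ℤ.suc x ℤ.+ + v
    head = begin
      0ℤ                               ≤⟨ 0≤2x+v ⟩
      + 2 ℤ.* x ℤ.+ + v                ≤⟨ ℤ.i≤i+j (+ 2 ℤ.* x ℤ.+ + v) (+ 2) ⟩
      (+ 2 ℤ.* x ℤ.+ + v) ℤ.+ + 2      ≡⟨ regroup x (+ v) ⟨
      + 2 ℤ.* ℤ.suc x ℤ.+ + v          ∎
    weight≤′ : weight (raise c) ℤ.≤ + m ℤ.* + suc t
    weight≤′ = begin
      weight (raise c)                 ≡⟨ weight-raise c ⟩
      weight c ℤ.+ + m                 ≤⟨ ℤ.+-monoˡ-≤ (+ m) weight≤ ⟩
      + m ℤ.* + t ℤ.+ + m              ≡⟨ level-suc t ⟨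
      + m ℤ.* + suc t                  ∎

  admissible-raise₀⁺ : ∀ {t} (c : Code 0) → Admissible 0 t c → Admissible 0 (suc t) (raise₀ c)
  admissible-raise₀⁺ {t} c@([] , v , w) (tt , weight≤) = tt , (begin
    weight (raise₀ c)                  ≡⟨ weight-raise₀ c ⟩
    weight c ℤ.+ + m                   ≤⟨ ℤ.+-monoˡ-≤ (+ m) weight≤ ⟩
    + m ℤ.* + t ℤ.+ + m                ≡⟨ level-suc t ⟨
    + m ℤ.* + suc t                    ∎)
    where open ℤ.≤-Reasoning

  admissible-base⁺ : ∀ {t} w → Admissible 0 (suc t) (base w)
  admissible-base⁺ {t} w = tt , subst₂ ℤ._≤_ (sym (weight₀ 0 w)) (ℤ.pos-* m (suc t)) (ℤ.+≤+ (begin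
    m ℕ.* 0 ℕ.+ toℕ w     ≡⟨ cong (ℕ._+ toℕ w) (ℕ.*-zeroʳ m) ⟩
    toℕ w                 ≤⟨ ℕ.<⇒≤ (Fin.toℕ<n w) ⟩
    m                     ≤⟨ ℕ.m≤m*n m (suc t) ⟩
    m ℕ.* suc t           ∎))
    where open ℕ.≤-Reasoning

  admissible-origin : Admissible 0 0 (base Fin.zero)
  admissible-origin = tt , ℤ.≤-reflexive (ℤ.+-identityʳ (+ m ℤ.* + 0))

  admissible-zero-zero⇔ : ∀ c → c ≡ base Fin.zero ⇔ Admissible 0 0 c
  admissible-zero-zero⇔ c = mk⇔ (λ { refl → admissible-origin }) (from c)
    where
    from : ∀ c → Admissible 0 0 c → c ≡ base Fin.zero
    from ([] , zero , Fin.zero) _ = refl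
    from ([] , zero , Fin.suc w) (tt , weight≤) =
      contradiction (level₀ 0 (Fin.suc w) weight≤) (ℕ.<⇒≱ (ℕ.m<m+n (m ℕ.* 0) (s≤s z≤n)))
    from ([] , suc v , w) (tt , weight≤) =
      contradiction (ℕ.≤-trans (ℕ.m≤m+n (m ℕ.* suc v) (toℕ w)) (level₀ (suc v) w weight≤))
                    (ℕ.<⇒≱ (ℕ.*-monoʳ-< m (s≤s z≤n)))

  admissible-zero-suc⇔ : ∀ t c → (Image base (λ _ → ⊤) c ⊎ Image raise₀ (Admissible 0 t) c) ⇔ Admissible 0 (suc t) c
  admissible-zero-suc⇔ t c = mk⇔ to (from c)
    where
    to : Image base (λ _ → ⊤) c ⊎ Image raise₀ (Admissible 0 t) c → Admissible 0 (suc t) c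
    to (inj₁ (w , tt , refl)) = admissible-base⁺ w
    to (inj₂ (c′ , admissible , refl)) = admissible-raise₀⁺ c′ admissible
    from : ∀ c → Admissible 0 (suc t) c → Image base (λ _ → ⊤) c ⊎ Image raise₀ (Admissible 0 t) c
    from ([] , zero , w) _ = inj₁ (w , tt , refl)
    from ([] , suc v , w) (tt , weight≤) =
      inj₂ (([] , v , w) , (tt , level-cancel t (subst (ℤ._≤ _) (weight-raise₀ ([] , v , w)) weight≤)) , refl)

  admissible-extend⁻ : ∀ {k t} β (c : Code k) → β ℕ.< 2 → Admissible (suc k) t (extend β c) →
    Image (extend 0) (Admissible k t) (extend β c) ⊎
    ∃ λ t′ → t ≡ suc t′ × (Image (extend 1) (Admissible k t′) (extend β c) ⊎ Image raise (Admissible (suc k) t′) (extend β c))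
  admissible-extend⁻ {t = t} zero c@(r , v , w) β<2 ((_ , bounded) , weight≤) =
    inj₁ (c , (boundedBelow-halve r β<2 bounded , subst (ℤ._≤ _) weight≡ weight≤) , refl)
    where
    weight≡ : weight (extend 0 c) ≡ weight c
    weight≡ = trans (weight-extend 0 c) (trans (cong (ℤ._+_ (weight c)) (ℤ.*-zeroʳ (+ m))) (ℤ.+-identityʳ (weight c)))
  admissible-extend⁻ {t = t} (suc zero) c@(r , v , w) β<2 ((_ , bounded) , weight≤)
    with level-pred t (weight-nonNeg r v w bounded′) (subst (ℤ._≤ _) weight≡ weight≤)
    where
    bounded′ : BoundedBelow 2 v r
    bounded′ = boundedBelow-halve r β<2 bounded
    weight≡ : weight (extend 1 c) ≡ weight c ℤ.+ + m
    weight≡ = trans (weight-extend 1 c) (cong (ℤ._+_ (weight c)) (ℤ.*-identityʳ (+ m)))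
  ... | t′ , refl , weight≤′ = inj₂ (t′ , refl , inj₁ (c , (boundedBelow-halve r β<2 bounded , weight≤′) , refl))
  admissible-extend⁻ (suc (suc _)) _ (s≤s (s≤s ())) _

  admissible-raise⁻ : ∀ {k t} x r V w → 0ℤ ℤ.≤ + 2 ℤ.* x ℤ.+ + V → Admissible (suc k) t (raise (x ∷ r , V , w)) →
    ∃ λ t′ → t ≡ suc t′ × Admissible (suc k) t′ (x ∷ r , V , w)
  admissible-raise⁻ {t = t} x r V w 0≤2x+V ((_ , bounded) , weight≤)
    with level-pred t (weight-nonNeg (x ∷ r) V w (0≤2x+V , bounded)) (subst (ℤ._≤ _) (weight-raise (x ∷ r , V , w)) weight≤)
  ... | t′ , t≡1+t′ , weight≤′ = t′ , t≡1+t′ , ((0≤2x+V , bounded) , weight≤′)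

  admissible-suc⁻ : ∀ {k t} (c : Code (suc k)) → Admissible (suc k) t c →
    Image (extend 0) (Admissible k t) c ⊎
    ∃ λ t′ → t ≡ suc t′ × (Image (extend 1) (Admissible k t′) c ⊎ Image raise (Admissible (suc k) t′) c)
  admissible-suc⁻ (x ∷ r , V , w) admissible@((0≤2x+V , _) , _) with parity V
  ... | β , v , β<2 , refl with zero-or-suc (x ℤ.+ + v) (head-halve x β v β<2 0≤2x+V)
  ...   | inj₁ x+v≡0 with trans (regroup x (+ v)) (trans (cong (ℤ._- + v) x+v≡0) (ℤ.+-identityˡ (ℤ.- + v)))
    where
    regroup : ∀ x v → x ≡ (x ℤ.+ v) ℤ.- v
    regroup = solve-∀
  ...     | refl = admissible-extend⁻ β (r , v , w) β<2 admissible
  admissible-suc⁻ (x ∷ r , V , w) admissible | β , v , β<2 , refl | inj₂ (n , x+v≡1+n)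
    with ℤ.pred x | sym (ℤ.suc-pred x)
  ... | y | refl with admissible-raise⁻ y r (β ℕ.+ 2 ℕ.* v) w 0≤2y+V admissible
    where
    regroup : ∀ y v → y ℤ.+ v ≡ (+ 1 ℤ.+ y ℤ.+ v) ℤ.- + 1
    regroup = solve-∀
    unshift : ∀ n → (+ 1 ℤ.+ n) ℤ.- + 1 ≡ n
    unshift = solve-∀
    y+v≡n : y ℤ.+ + v ≡ + n
    y+v≡n = trans (regroup y (+ v)) (trans (cong (ℤ._- + 1) x+v≡1+n) (unshift (+ n)))
    0≤2y+V : 0ℤ ℤ.≤ + 2 ℤ.* y ℤ.+ + (β ℕ.+ 2 ℕ.* v)
    0≤2y+V = subst (0ℤ ℤ.≤_) (sym (trans (halving y β v) (cong (λ z → + 2 ℤ.* z ℤ.+ + β) y+v≡n)))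
                   (0≤a*X+b 2 β {+ n} (ℤ.+≤+ z≤n))
  ...   | t′ , t≡1+t′ , admissible′ = inj₂ (t′ , t≡1+t′ , inj₂ ((y ∷ r , β ℕ.+ 2 ℕ.* v , w) , admissible′ , refl))

  admissible-suc-zero⇔ : ∀ k c → Image (extend 0) (Admissible k 0) c ⇔ Admissible (suc k) 0 c
  admissible-suc-zero⇔ k c = mk⇔ to from
    where
    to : Image (extend 0) (Admissible k 0) c → Admissible (suc k) 0 c
    to (c′ , admissible , refl) = admissible-extend⁺ 0 c′ admissible
    from : Admissible (suc k) 0 c → Image (extend 0) (Admissible k 0) c
    from admissible with admissible-suc⁻ {t = 0} c admissible
    ... | inj₁ image = image
    ... | inj₂ (_ , () , _)

  admissible-suc-suc⇔ : ∀ k t c →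
    (Image (extend 0) (Admissible k (suc t)) c ⊎ (Image (extend 1) (Admissible k t) c ⊎ Image raise (Admissible (suc k) t) c))
    ⇔ Admissible (suc k) (suc t) c
  admissible-suc-suc⇔ k t c = mk⇔ to from
    where
    Pieces : Set
    Pieces = Image (extend 0) (Admissible k (suc t)) c ⊎ (Image (extend 1) (Admissible k t) c ⊎ Image raise (Admissible (suc k) t) c)
    to : Pieces → Admissible (suc k) (suc t) c
    to (inj₁ (c′ , admissible , refl)) = admissible-extend⁺ {t = suc t} 0 c′ admissible
    to (inj₂ (inj₁ (c′ , admissible , refl))) = admissible-extend⁺ 1 c′ admissible
    to (inj₂ (inj₂ (c′ , admissible , refl))) = admissible-raise⁺ c′ admissible
    from : Admissible (suc k) (suc t) c → Pieces
    from admissible with admissible-suc⁻ {t = suc t} c admissible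
    ... | inj₁ image = inj₁ image
    ... | inj₂ (_ , refl , image) = inj₂ image

  base-injective : ∀ {w w′} → base w ≡ base w′ → w ≡ w′
  base-injective refl = refl

  raise₀-injective : ∀ {c c′} → raise₀ c ≡ raise₀ c′ → c ≡ c′
  raise₀-injective {[] , v , w} {[] , .v , .w} refl = refl

  extend-injective : ∀ {k} β {c c′ : Code k} → extend β c ≡ extend β c′ → c ≡ c′
  extend-injective β {r , v , w} {r′ , v′ , w′} eq with Vec.∷-injective (cong proj₁ eq) | cong (proj₂ ∘ proj₂) eq
  ... | -v≡-v′ , refl | refl with ℤ.+-injective (ℤ.neg-injective -v≡-v′)
  ... | refl = refl

  raise-injective : ∀ {k} {c c′ : Code (suc k)} → raise c ≡ raise c′ → c ≡ c′
  raise-injective {c = x ∷ r , v , w} {x′ ∷ r′ , v′ , w′} eq with Vec.∷-injective (cong proj₁ eq) | cong proj₂ eq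
  ... | 1+x≡1+x′ , refl | refl = cong (λ y → y ∷ r , v , w) x≡x′
    where
    x≡x′ : x ≡ x′
    x≡x′ = trans (sym (ℤ.pred-suc x)) (trans (cong ℤ.pred 1+x≡1+x′) (ℤ.pred-suc x′))

  base≢raise₀ : ∀ w c → base w ≢ raise₀ c
  base≢raise₀ w ([] , v , w′) ()

  extend₀≢extend₁ : ∀ {k} (c c′ : Code k) → extend 0 c ≢ extend 1 c′
  extend₀≢extend₁ (r , v , w) (r′ , v′ , w′) eq = ℕ.even≢odd v v′ (cong (proj₁ ∘ proj₂) eq)

  extend≢raise : ∀ {k t β} (c : Code k) (c′ : Code (suc k)) → β ℕ.< 2 → Admissible (suc k) t c′ → extend β c ≢ raise c′
  extend≢raise {β = β} (r , v , w) (x ∷ r′ , V , w′) β<2 ((0≤2x+V , _) , _) eq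
    with Vec.∷-injective (cong proj₁ eq) | cong (proj₁ ∘ proj₂) eq
  ... | -v≡1+x , _ | refl = contradiction 0≤2x+V (ℤ.<⇒≱ (begin-strict
    + 2 ℤ.* x ℤ.+ + (β ℕ.+ 2 ℕ.* v)   ≡⟨ halving x β v ⟩
    + 2 ℤ.* (x ℤ.+ + v) ℤ.+ + β       ≡⟨ cong (λ z → + 2 ℤ.* z ℤ.+ + β) x+v≡-1 ⟩
    + 2 ℤ.* -[1+ 0 ] ℤ.+ + β          ≡⟨ regroup (+ β) ⟩
    + β ℤ.- + 2                       <⟨ b-a<0 β<2 ⟩
    0ℤ                                ∎))
    where
    open ℤ.≤-Reasoning
    regroup : ∀ β → + 2 ℤ.* -[1+ 0 ] ℤ.+ β ≡ β ℤ.- + 2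
    regroup = solve-∀
    negate : ∀ x v → x ℤ.+ v ≡ x ℤ.- ℤ.- v
    negate = solve-∀
    cancel : ∀ x → x ℤ.- (+ 1 ℤ.+ x) ≡ ℤ.- + 1
    cancel = solve-∀
    x+v≡-1 : x ℤ.+ + v ≡ -[1+ 0 ]
    x+v≡-1 = trans (negate x (+ v)) (trans (cong (ℤ._-_ x) -v≡1+x) (cancel x))

  codes : ∀ k → ℕ → List (Code k)
  codes zero zero = [ base Fin.zero ]
  codes zero (suc t) = map base (allFin m) ++ map raise₀ (codes zero t)
  codes (suc k) zero = map (extend 0) (codes k zero)
  codes (suc k) (suc t) = map (extend 0) (codes k (suc t)) ++ (map (extend 1) (codes k t) ++ map raise (codes (suc k) t))

  codes-enumerate : ∀ k t → Enumerates (Admissible k t) (codes k t)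
  codes-enumerate zero zero = enumerates-⇔ admissible-zero-zero⇔ (enumerates-singleton (base Fin.zero))
  codes-enumerate zero (suc t) = enumerates-⇔ (admissible-zero-suc⇔ t)
    (enumerates-++ (λ { _ (w , _ , refl) (c , _ , eq) → base≢raise₀ w c eq })
      (enumerates-map base base-injective (enumerates-allFin m))
      (enumerates-map raise₀ raise₀-injective (codes-enumerate zero t)))
  codes-enumerate (suc k) zero = enumerates-⇔ (admissible-suc-zero⇔ k)
    (enumerates-map (extend 0) (extend-injective 0) (codes-enumerate k zero))
  codes-enumerate (suc k) (suc t) = enumerates-⇔ (admissible-suc-suc⇔ k t)
    (enumerates-++ extend₀-apart
      (enumerates-map (extend 0) (extend-injective 0) (codes-enumerate k (suc t)))
      (enumerates-++ extend₁-apart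
        (enumerates-map (extend 1) (extend-injective 1) (codes-enumerate k t))
        (enumerates-map raise raise-injective (codes-enumerate (suc k) t))))
    where
    extend₀-apart : ∀ c → Image (extend 0) (Admissible k (suc t)) c →
      ¬ (Image (extend 1) (Admissible k t) c ⊎ Image raise (Admissible (suc k) t) c)
    extend₀-apart _ (c₀ , _ , refl) (inj₁ (c₁ , _ , eq)) = extend₀≢extend₁ c₀ c₁ eq
    extend₀-apart _ (c₀ , _ , refl) (inj₂ (c₂ , admissible , eq)) = extend≢raise c₀ c₂ (s≤s z≤n) admissible eq
    extend₁-apart : ∀ c → Image (extend 1) (Admissible k t) c → ¬ Image raise (Admissible (suc k) t) c
    extend₁-apart _ (c₁ , _ , refl) (c₂ , admissible , eq) = extend≢raise c₁ c₂ (s≤s (s≤s z≤n)) admissible eq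

  length-codes : ∀ k t → length (codes k t) ≡ pointCount m k t
  length-codes zero zero = refl
  length-codes zero (suc t) = begin
    length (map base (allFin m) ++ map raise₀ (codes zero t))
      ≡⟨ List.length-++ (map base (allFin m)) ⟩
    length (map base (allFin m)) ℕ.+ length (map raise₀ (codes zero t))
      ≡⟨ cong₂ ℕ._+_ (trans (List.length-map base (allFin m)) (List.length-tabulate {n = m} (λ i → i)))
                     (trans (List.length-map raise₀ (codes zero t)) (length-codes zero t)) ⟩
    m ℕ.+ pointCount m zero t                                              ∎
    where open ≡-Reasoning
  length-codes (suc k) zero = trans (List.length-map (extend 0) (codes k zero)) (length-codes k zero)
  length-codes (suc k) (suc t) = begin
    length (map (extend 0) (codes k (suc t)) ++ (map (extend 1) (codes k t) ++ map raise (codes (suc k) t)))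
      ≡⟨ List.length-++ (map (extend 0) (codes k (suc t))) ⟩
    length (map (extend 0) (codes k (suc t))) ℕ.+ length (map (extend 1) (codes k t) ++ map raise (codes (suc k) t))
      ≡⟨ cong (length (map (extend 0) (codes k (suc t))) ℕ.+_) (List.length-++ (map (extend 1) (codes k t))) ⟩
    length (map (extend 0) (codes k (suc t))) ℕ.+ (length (map (extend 1) (codes k t)) ℕ.+ length (map raise (codes (suc k) t)))
      ≡⟨ cong₂ ℕ._+_ (lengthOf (extend 0) (codes k (suc t)) (length-codes k (suc t)))
                     (cong₂ ℕ._+_ (lengthOf (extend 1) (codes k t) (length-codes k t))
                                  (lengthOf raise (codes (suc k) t) (length-codes (suc k) t))) ⟩
    pointCount m k (suc t) ℕ.+ (pointCount m k t ℕ.+ pointCount m (suc k) t)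
      ∎
    where
    open ≡-Reasoning
    lengthOf : ∀ {A B : Set} (f : A → B) xs {n} → length xs ≡ n → length (map f xs) ≡ n
    lengthOf f xs eq = trans (List.length-map f xs) eq

  facetValue : ∀ {n} → Vec ℤ n → ℤ → Fin n → ℤ
  facetValue {n} ps y j = + (m ℕ.* 2 ^ (n ∸ toℕ j)) ℤ.* lookup ps j ℤ.+ y

  InHalfspaces : ∀ {n} → ℕ → Vec ℤ n → ℤ → Set
  InHalfspaces t ps y = 0ℤ ℤ.≤ y × (∀ j → 0ℤ ℤ.≤ facetValue ps y j) × + m ℤ.* ℤΣ.sum (lookup ps) ℤ.+ y ℤ.≤ + m ℤ.* + t

  toPoint : ∀ {n} → Code n → Vec ℤ (suc n)
  toPoint (r , v , w) = reverse r ∷ʳ + (m ℕ.* v ℕ.+ toℕ w)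

  scaled-facet : ∀ a X v w → + (m ℕ.* a) ℤ.* X ℤ.+ + (m ℕ.* v ℕ.+ w) ≡ + m ℤ.* (+ a ℤ.* X ℤ.+ + v) ℤ.+ + w
  scaled-facet a X v w =
    trans (cong₂ (λ c y → c ℤ.* X ℤ.+ y) (ℤ.pos-* m a) (trans (ℤ.pos-+ (m ℕ.* v) w) (cong (ℤ._+ + w) (ℤ.pos-* m v))))
          (regroup (+ m) (+ a) X (+ v) (+ w))
    where
    regroup : ∀ m a X v w → m ℤ.* a ℤ.* X ℤ.+ (m ℤ.* v ℤ.+ w) ≡ m ℤ.* (a ℤ.* X ℤ.+ v) ℤ.+ w
    regroup = solve-∀

  budget≡weight : ∀ {n} (r : Vec ℤ n) v w → + m ℤ.* ℤΣ.sum (lookup (reverse r)) ℤ.+ + (m ℕ.* v ℕ.+ toℕ w) ≡ weight (r , v , w)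
  budget≡weight r v w =
    trans (cong₂ (λ s y → + m ℤ.* s ℤ.+ y) (sum-reverse r) (trans (ℤ.pos-+ (m ℕ.* v) (toℕ w)) (cong (ℤ._+ + toℕ w) (ℤ.pos-* m v))))
          (regroup (+ m) (ℤΣ.sum (lookup r)) (+ v) (+ toℕ w))
    where
    regroup : ∀ m s v w → m ℤ.* s ℤ.+ (m ℤ.* v ℤ.+ w) ≡ m ℤ.* (s ℤ.+ v) ℤ.+ w
    regroup = solve-∀

  inHalfspaces⇔toPoint : ∀ {n} t ps y → InHalfspaces t ps y ⇔ Image toPoint (Admissible n t) (ps ∷ʳ y)
  inHalfspaces⇔toPoint {n} t ps y = mk⇔ (to ps y) (from ps y)
    where
    to : ∀ ps y → InHalfspaces t ps y → Image toPoint (Admissible n t) (ps ∷ʳ y)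
    to ps (+ Y) (_ , facets , budget) = (reverse ps , q , w) , (bounded , weight≤) , point≡
      where
      q = Y ℕ./ m
      w = fromℕ< (m%n<n Y m)
      Y≡ : Y ≡ m ℕ.* q ℕ.+ toℕ w
      Y≡ = trans (m≡m%n+[m/n]*n Y m) (trans (ℕ.+-comm (Y ℕ.% m) (q ℕ.* m))
                 (cong₂ ℕ._+_ (ℕ.*-comm q m) (sym (Fin.toℕ-fromℕ< (m%n<n Y m)))))
      facet : ∀ i → 0ℤ ℤ.≤ + (2 ℕ.* 2 ^ toℕ i) ℤ.* lookup (reverse ps) i ℤ.+ + q
      facet i = nonNeg-cancel _ (Fin.toℕ<n w) (subst (0ℤ ℤ.≤_) eq (facets (opposite i)))
        where
        eq : + (m ℕ.* 2 ^ (n ∸ toℕ (opposite i))) ℤ.* lookup ps (opposite i) ℤ.+ + Y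
           ≡ + m ℤ.* (+ (2 ℕ.* 2 ^ toℕ i) ℤ.* lookup (reverse ps) i ℤ.+ + q) ℤ.+ + toℕ w
        eq = trans (cong₂ (λ a X → + (m ℕ.* a) ℤ.* X ℤ.+ + Y)
                          (trans (2^[n∸j]≡2*2^opposite (opposite i)) (cong (λ j → 2 ℕ.* 2 ^ toℕ j) (Fin.opposite-involutive i)))
                          (sym (lookup-reverse ps i)))
             (trans (cong (λ y → + (m ℕ.* (2 ℕ.* 2 ^ toℕ i)) ℤ.* lookup (reverse ps) i ℤ.+ + y) Y≡)
                    (scaled-facet (2 ℕ.* 2 ^ toℕ i) (lookup (reverse ps) i) q (toℕ w)))
      bounded : BoundedBelow 2 q (reverse ps)
      bounded = Equivalence.from (boundedBelow⇔ 2 q (reverse ps)) facet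
      weight≤ : weight (reverse ps , q , w) ℤ.≤ + m ℤ.* + t
      weight≤ = subst (ℤ._≤ _) (trans (cong₂ (λ xs y → + m ℤ.* ℤΣ.sum (lookup xs) ℤ.+ + y) (sym (Vec.reverse-involutive ps)) Y≡)
                                       (budget≡weight (reverse ps) q w)) budget
      point≡ : ps ∷ʳ + Y ≡ toPoint (reverse ps , q , w)
      point≡ = cong₂ _∷ʳ_ (sym (Vec.reverse-involutive ps)) (cong +_ Y≡)
    from : ∀ ps y → Image toPoint (Admissible n t) (ps ∷ʳ y) → InHalfspaces t ps y
    from ps y ((r , v , w) , (bounded , weight≤) , point≡) with Vec.∷ʳ-injective ps (reverse r) point≡
    ... | refl , refl = ℤ.+≤+ z≤n , facets , subst (ℤ._≤ _) (sym (budget≡weight r v w)) weight≤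
      where
      facets : ∀ j → 0ℤ ℤ.≤ + (m ℕ.* 2 ^ (n ∸ toℕ j)) ℤ.* lookup (reverse r) j ℤ.+ + (m ℕ.* v ℕ.+ toℕ w)
      facets j = subst (0ℤ ℤ.≤_) (sym eq) (0≤a*X+b m (toℕ w) (Equivalence.to (boundedBelow⇔ 2 v r) bounded (opposite j)))
        where
        eq : + (m ℕ.* 2 ^ (n ∸ toℕ j)) ℤ.* lookup (reverse r) j ℤ.+ + (m ℕ.* v ℕ.+ toℕ w)
           ≡ + m ℤ.* (+ (2 ℕ.* 2 ^ toℕ (opposite j)) ℤ.* lookup r (opposite j) ℤ.+ + v) ℤ.+ + toℕ w
        eq = trans (cong₂ (λ a X → + (m ℕ.* a) ℤ.* X ℤ.+ + (m ℕ.* v ℕ.+ toℕ w)) (2^[n∸j]≡2*2^opposite j) (lookup-reverse r j))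
                   (scaled-facet (2 ℕ.* 2 ^ toℕ (opposite j)) (lookup r (opposite j)) v (toℕ w))

  remainder-of : ∀ v (w : Fin m) → (m ℕ.* v ℕ.+ toℕ w) ℕ.% m ≡ toℕ w
  remainder-of v w = begin
    (m ℕ.* v ℕ.+ toℕ w) ℕ.% m     ≡⟨ cong (ℕ._% m) (trans (ℕ.+-comm (m ℕ.* v) (toℕ w)) (cong (toℕ w ℕ.+_) (ℕ.*-comm m v))) ⟩
    (toℕ w ℕ.+ v ℕ.* m) ℕ.% m     ≡⟨ [m+kn]%n≡m%n (toℕ w) v m ⟩
    toℕ w ℕ.% m                 ≡⟨ m<n⇒m%n≡m (Fin.toℕ<n w) ⟩
    toℕ w                       ∎
    where open ≡-Reasoning

  quotient-remainder-unique : ∀ {v v′} {w w′ : Fin m} → m ℕ.* v ℕ.+ toℕ w ≡ m ℕ.* v′ ℕ.+ toℕ w′ → v ≡ v′ × w ≡ w′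
  quotient-remainder-unique {v} {v′} {w} {w′} eq
    with Fin.toℕ-injective (trans (sym (remainder-of v w)) (trans (cong (ℕ._% m) eq) (remainder-of v′ w′)))
  ... | refl = ℕ.*-cancelˡ-≡ v v′ m (ℕ.+-cancelʳ-≡ (toℕ w) (m ℕ.* v) (m ℕ.* v′) eq) , refl

  toPoint-injective : ∀ {n} {c c′ : Code n} → toPoint c ≡ toPoint c′ → c ≡ c′
  toPoint-injective {c = r , v , w} {r′ , v′ , w′} eq with Vec.∷ʳ-injective (reverse r) (reverse r′) eq
  ... | reverse≡ , y≡
    with Vec.reverse-injective {xs = r} {ys = r′} reverse≡ | quotient-remainder-unique {v} {v′} {w} {w′} (ℤ.+-injective y≡)
  ... | refl | refl , refl = refl

ι : ℤ → ℚ
ι i = mkℚ i 0 (coprime-sym (1-coprimeTo ℤ.∣ i ∣))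

ι-/1 : ∀ i → i ℚ./ 1 ≡ ι i
ι-/1 (+ n) = ℚ.normalize-coprime (coprime-sym (1-coprimeTo n))
ι-/1 -[1+ n ] = cong ℚ.-_ (ℚ.normalize-coprime (coprime-sym (1-coprimeTo (suc n))))

ι-+ : ∀ a b → ι (a ℤ.+ b) ≡ ι a ℚ.+ ι b
ι-+ a b = sym (trans (cong (ℚ._/ 1) (cong₂ ℤ._+_ (ℤ.*-identityʳ a) (ℤ.*-identityʳ b))) (ι-/1 (a ℤ.+ b)))

ι-* : ∀ a b → ι (a ℤ.* b) ≡ ι a ℚ.* ι b
ι-* a b = sym (ι-/1 (a ℤ.* b))

ι-nonNeg⇔ : ∀ {a} → 0ℤ ℤ.≤ a ⇔ 0ℚ ℚ.≤ ι a
ι-nonNeg⇔ {a} = mk⇔ (λ 0≤a → ℚ.*≤* (subst₂ ℤ._≤_ refl (sym (ℤ.*-identityʳ a)) 0≤a))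
                    (λ { (ℚ.*≤* 0≤a*1) → subst₂ ℤ._≤_ refl (ℤ.*-identityʳ a) 0≤a*1 })

ι-sum : ∀ {n} (f : Fin n → ℤ) → ℚΣ.sum (ι ∘ f) ≡ ι (ℤΣ.sum f)
ι-sum {zero} f = refl
ι-sum {suc n} f = trans (cong (ι (f Fin.zero) ℚ.+_) (ι-sum (f ∘ Fin.suc))) (sym (ι-+ (f Fin.zero) (ℤΣ.sum (f ∘ Fin.suc))))

ΣQ≡sum : ∀ n (f : Fin n → ℚ) → ΣQ n f ≡ ℚΣ.sum f
ΣQ≡sum zero f = refl
ΣQ≡sum (suc n) f = cong (f Fin.zero ℚ.+_) (ΣQ≡sum n (f ∘ Fin.suc))

δ : ℕ → ℕ → ℚ
δ a b = if does (a ≟ b) then 1ℚ else 0ℚ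

∑-δ : ∀ {k} (f : Fin k → ℚ) (j : Fin k) → ℚΣ.sum (λ i → f i ℚ.* δ (toℕ i) (toℕ j)) ≡ f j
∑-δ {suc k} f Fin.zero = begin
  f Fin.zero ℚ.* 1ℚ ℚ.+ ℚΣ.sum (λ i → f (Fin.suc i) ℚ.* 0ℚ)
    ≡⟨ cong₂ ℚ._+_ (ℚ.*-identityʳ (f Fin.zero)) (trans (ℚΣ.sum-cong-≗ (λ i → ℚ.*-zeroʳ (f (Fin.suc i)))) (ℚΣ.sum-replicate-zero k)) ⟩
  f Fin.zero ℚ.+ 0ℚ
    ≡⟨ ℚ.+-identityʳ (f Fin.zero) ⟩
  f Fin.zero ∎
  where open ≡-Reasoning
∑-δ f (Fin.suc j) = trans (cong₂ ℚ._+_ (ℚ.*-zeroʳ (f Fin.zero)) (∑-δ (f ∘ Fin.suc) j)) (ℚ.+-identityˡ (f (Fin.suc j)))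

∑-δ-beyond : ∀ {k} (f : Fin k → ℚ) a → k ℕ.≤ a → ℚΣ.sum (λ i → f i ℚ.* δ (toℕ i) a) ≡ 0ℚ
∑-δ-beyond {zero} f a _ = refl
∑-δ-beyond {suc k} f (suc a) (s≤s k≤a) =
  trans (cong₂ ℚ._+_ (ℚ.*-zeroʳ (f Fin.zero)) (∑-δ-beyond (f ∘ Fin.suc) a k≤a)) (ℚ.+-identityʳ 0ℚ)

-- Barycentric coordinates in Δ

module Simplex (n m-1 : ℕ) where

  open Codes m-1 using (m; facetValue; InHalfspaces)

  N : ℕ
  N = m ℕ.* 2 ^ n

  instance
    N-nonZero : ℕ.NonZero N
    N-nonZero = ℕ.m*n≢0 m (2 ^ n) {{_}} {{ℕ.m^n≢0 2 n}}

  vertex : Fin (suc (suc n)) → Vec ℚ (suc n)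
  vertex = ΔVert (suc n) m

  apex : Fin (suc (suc n))
  apex = fromℕ (suc n)

  unit : Fin n → Fin (suc (suc n))
  unit i = Fin.suc (inject₁ i)

  apexCoordinate : Fin (suc n) → ℚ
  apexCoordinate j =
    if does (suc (toℕ j) ≟ suc n) then (+ (m ℕ.* 2 ^ (suc n ∸ 1))) ℚ./ 1 else ℚ.- ((+ (2 ^ toℕ j)) ℚ./ 1)

  -- the function tabulated in ΔVert, spelled out so that lookup∘tabulate applies
  coordinate : Fin (suc (suc n)) → Fin (suc n) → ℚ
  coordinate k j = if does (toℕ k ≟ suc n) then apexCoordinate j else δ (toℕ k) (suc (toℕ j))

  lookup-vertex : ∀ k j → lookup (vertex k) j ≡ coordinate k j
  lookup-vertex k = Vec.lookup∘tabulate (coordinate k)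

  vertex-origin : ∀ j → lookup (vertex Fin.zero) j ≡ 0ℚ
  vertex-origin = lookup-vertex Fin.zero

  vertex-unit : ∀ i j → lookup (vertex (unit i)) j ≡ δ (toℕ i) (toℕ j)
  vertex-unit i j = begin
    lookup (vertex (unit i)) j
      ≡⟨ lookup-vertex (unit i) j ⟩
    coordinate (unit i) j
      ≡⟨ cong (λ b → if b then apexCoordinate j else δ (toℕ (inject₁ i)) (toℕ j)) (dec-false (toℕ (unit i) ≟ suc n) unit≢apex) ⟩
    δ (toℕ (inject₁ i)) (toℕ j)
      ≡⟨ cong (λ a → δ a (toℕ j)) (Fin.toℕ-inject₁ i) ⟩
    δ (toℕ i) (toℕ j) ∎
    where
    open ≡-Reasoning
    unit≢apex : toℕ (unit i) ≢ suc n
    unit≢apex eq = ℕ.<-irrefl (ℕ.suc-injective eq) (subst (ℕ._< n) (sym (Fin.toℕ-inject₁ i)) (Fin.toℕ<n i))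

  vertex-apex : ∀ j → lookup (vertex apex) j ≡ apexCoordinate j
  vertex-apex j = trans (lookup-vertex apex j)
    (cong (λ b → if b then apexCoordinate j else δ (toℕ apex) (suc (toℕ j))) (dec-true (toℕ apex ≟ suc n) (Fin.toℕ-fromℕ (suc n))))

  vertex-apex-init : ∀ i → lookup (vertex apex) (inject₁ i) ≡ ℚ.- ι (+ 2 ^ toℕ i)
  vertex-apex-init i = begin
    lookup (vertex apex) (inject₁ i)
      ≡⟨ vertex-apex (inject₁ i) ⟩
    apexCoordinate (inject₁ i)
      ≡⟨ cong (λ b → if b then (+ N) ℚ./ 1 else ℚ.- ((+ (2 ^ toℕ (inject₁ i))) ℚ./ 1))
              (dec-false (suc (toℕ (inject₁ i)) ≟ suc n) init≢last) ⟩
    ℚ.- ((+ (2 ^ toℕ (inject₁ i))) ℚ./ 1)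
      ≡⟨ cong (λ a → ℚ.- ((+ (2 ^ a)) ℚ./ 1)) (Fin.toℕ-inject₁ i) ⟩
    ℚ.- ((+ (2 ^ toℕ i)) ℚ./ 1)
      ≡⟨ cong ℚ.-_ (ι-/1 (+ (2 ^ toℕ i))) ⟩
    ℚ.- ι (+ 2 ^ toℕ i) ∎
    where
    open ≡-Reasoning
    init≢last : suc (toℕ (inject₁ i)) ≢ suc n
    init≢last eq = ℕ.<-irrefl (ℕ.suc-injective eq) (subst (ℕ._< n) (sym (Fin.toℕ-inject₁ i)) (Fin.toℕ<n i))

  vertex-apex-last : lookup (vertex apex) (fromℕ n) ≡ ι (+ N)
  vertex-apex-last = begin
    lookup (vertex apex) (fromℕ n)
      ≡⟨ vertex-apex (fromℕ n) ⟩
    apexCoordinate (fromℕ n)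
      ≡⟨ cong (λ b → if b then (+ N) ℚ./ 1 else ℚ.- ((+ (2 ^ toℕ (fromℕ n))) ℚ./ 1))
              (dec-true (suc (toℕ (fromℕ n)) ≟ suc n) (cong suc (Fin.toℕ-fromℕ n))) ⟩
    (+ N) ℚ./ 1
      ≡⟨ ι-/1 (+ N) ⟩
    ι (+ N) ∎
    where open ≡-Reasoning

  ΣQ-vertices : ∀ (g : Fin (suc (suc n)) → ℚ) → ΣQ (suc (suc n)) g ≡ g Fin.zero ℚ.+ (ℚΣ.sum (g ∘ unit) ℚ.+ g apex)
  ΣQ-vertices g = trans (ΣQ≡sum _ g) (cong (g Fin.zero ℚ.+_) (ℚΣ.sum-init-last (g ∘ Fin.suc)))

  combination : (Fin (suc (suc n)) → ℚ) → Fin (suc n) → ℚ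
  combination λs j = ΣQ (suc (suc n)) (λ k → λs k ℚ.* lookup (vertex k) j)

  combination-split : ∀ λs j → combination λs j ≡
    ℚΣ.sum (λ i → λs (unit i) ℚ.* δ (toℕ i) (toℕ j)) ℚ.+ λs apex ℚ.* lookup (vertex apex) j
  combination-split λs j = begin
    combination λs j
      ≡⟨ ΣQ-vertices (λ k → λs k ℚ.* lookup (vertex k) j) ⟩
    λs Fin.zero ℚ.* lookup (vertex Fin.zero) j ℚ.+
      (ℚΣ.sum (λ i → λs (unit i) ℚ.* lookup (vertex (unit i)) j) ℚ.+ λs apex ℚ.* lookup (vertex apex) j)
      ≡⟨ cong₂ (λ a b → a ℚ.+ (b ℚ.+ λs apex ℚ.* lookup (vertex apex) j))
               (trans (cong (λs Fin.zero ℚ.*_) (vertex-origin j)) (ℚ.*-zeroʳ (λs Fin.zero)))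
               (ℚΣ.sum-cong-≗ (λ i → cong (λs (unit i) ℚ.*_) (vertex-unit i j))) ⟩
    0ℚ ℚ.+ (ℚΣ.sum (λ i → λs (unit i) ℚ.* δ (toℕ i) (toℕ j)) ℚ.+ λs apex ℚ.* lookup (vertex apex) j)
      ≡⟨ ℚ.+-identityˡ _ ⟩
    ℚΣ.sum (λ i → λs (unit i) ℚ.* δ (toℕ i) (toℕ j)) ℚ.+ λs apex ℚ.* lookup (vertex apex) j ∎
    where open ≡-Reasoning

  combination-init : ∀ λs i → combination λs (inject₁ i) ≡ λs (unit i) ℚ.+ λs apex ℚ.* ℚ.- ι (+ 2 ^ toℕ i)
  combination-init λs i = trans (combination-split λs (inject₁ i)) (cong₂ ℚ._+_ units (cong (λs apex ℚ.*_) (vertex-apex-init i)))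
    where
    units : ℚΣ.sum (λ i′ → λs (unit i′) ℚ.* δ (toℕ i′) (toℕ (inject₁ i))) ≡ λs (unit i)
    units = trans (ℚΣ.sum-cong-≗ (λ i′ → cong (λ a → λs (unit i′) ℚ.* δ (toℕ i′) a) (Fin.toℕ-inject₁ i))) (∑-δ (λs ∘ unit) i)

  combination-last : ∀ λs → combination λs (fromℕ n) ≡ λs apex ℚ.* ι (+ N)
  combination-last λs = begin
    combination λs (fromℕ n)
      ≡⟨ combination-split λs (fromℕ n) ⟩
    ℚΣ.sum (λ i → λs (unit i) ℚ.* δ (toℕ i) (toℕ (fromℕ n))) ℚ.+ λs apex ℚ.* lookup (vertex apex) (fromℕ n)
      ≡⟨ cong₂ ℚ._+_ (∑-δ-beyond (λs ∘ unit) (toℕ (fromℕ n)) (ℕ.≤-reflexive (sym (Fin.toℕ-fromℕ n))))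
                     (cong (λs apex ℚ.*_) vertex-apex-last) ⟩
    0ℚ ℚ.+ λs apex ℚ.* ι (+ N)
      ≡⟨ ℚ.+-identityˡ _ ⟩
    λs apex ℚ.* ι (+ N) ∎
    where open ≡-Reasoning

  *-cancelʳ-ιN : ∀ {a b} → a ℚ.* ι (+ N) ≡ b ℚ.* ι (+ N) → a ≡ b
  *-cancelʳ-ιN {a} {b} eq = begin
    a                                    ≡⟨ unscale a ⟨
    a ℚ.* ι (+ N) ℚ.* ℚ.1/ ι (+ N)       ≡⟨ cong (ℚ._* ℚ.1/ ι (+ N)) eq ⟩
    b ℚ.* ι (+ N) ℚ.* ℚ.1/ ι (+ N)       ≡⟨ unscale b ⟩
    b                                    ∎
    where
    open ≡-Reasoning
    unscale : ∀ a → a ℚ.* ι (+ N) ℚ.* ℚ.1/ ι (+ N) ≡ a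
    unscale a = trans (ℚ.*-assoc a (ι (+ N)) (ℚ.1/ ι (+ N))) (trans (cong (a ℚ.*_) (ℚ.*-inverseʳ (ι (+ N)))) (ℚ.*-identityʳ a))

  combination-injective : ∀ λs λs′ → ΣQ (suc (suc n)) λs ≡ ΣQ (suc (suc n)) λs′ →
    (∀ j → combination λs j ≡ combination λs′ j) → ∀ k → λs k ≡ λs′ k
  combination-injective λs λs′ total≡ combination≡ = coordinate≡
    where
    apex≡ : λs apex ≡ λs′ apex
    apex≡ = *-cancelʳ-ιN (trans (sym (combination-last λs)) (trans (combination≡ (fromℕ n)) (combination-last λs′)))
    unit≡ : ∀ i → λs (unit i) ≡ λs′ (unit i)
    unit≡ i = ∙-cancelʳ (λs apex ℚ.* ℚ.- ι (+ 2 ^ toℕ i)) (λs (unit i)) (λs′ (unit i))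
      (trans (sym (combination-init λs i)) (trans (combination≡ (inject₁ i))
             (trans (combination-init λs′ i) (cong (λ a → λs′ (unit i) ℚ.+ a ℚ.* ℚ.- ι (+ 2 ^ toℕ i)) (sym apex≡)))))
    origin≡ : λs Fin.zero ≡ λs′ Fin.zero
    origin≡ = ∙-cancelʳ (ℚΣ.sum (λs ∘ unit) ℚ.+ λs apex) (λs Fin.zero) (λs′ Fin.zero)
      (trans (sym (ΣQ-vertices λs)) (trans total≡
             (trans (ΣQ-vertices λs′) (cong (λs′ Fin.zero ℚ.+_) (sym (cong₂ ℚ._+_ (ℚΣ.sum-cong-≗ unit≡) apex≡))))))
    coordinate≡ : ∀ k → λs k ≡ λs′ k
    coordinate≡ Fin.zero = origin≡
    coordinate≡ (Fin.suc k) with initOrLast k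
    ... | init i = unit≡ i
    ... | last = apex≡

  2^i*m2^[n∸i]≡N : ∀ (i : Fin n) → 2 ^ toℕ i ℕ.* (m ℕ.* 2 ^ (n ∸ toℕ i)) ≡ N
  2^i*m2^[n∸i]≡N i = begin
    2 ^ toℕ i ℕ.* (m ℕ.* 2 ^ (n ∸ toℕ i))     ≡⟨ regroup (2 ^ toℕ i) m (2 ^ (n ∸ toℕ i)) ⟩
    m ℕ.* (2 ^ toℕ i ℕ.* 2 ^ (n ∸ toℕ i))     ≡⟨ cong (m ℕ.*_) (ℕ.^-distribˡ-+-* 2 (toℕ i) (n ∸ toℕ i)) ⟨
    m ℕ.* 2 ^ (toℕ i ℕ.+ (n ∸ toℕ i))         ≡⟨ cong (λ e → m ℕ.* 2 ^ e) (ℕ.m+[n∸m]≡n (ℕ.<⇒≤ (Fin.toℕ<n i))) ⟩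
    N                                         ∎
    where
    open ≡-Reasoning
    regroup : ∀ a b c → a ℕ.* (b ℕ.* c) ≡ b ℕ.* (a ℕ.* c)
    regroup = ℕ-Solver.solve-∀

  budget : ℕ → Vec ℤ n → ℤ → ℤ
  budget t ps y = + m ℤ.* + t ℤ.- (+ m ℤ.* ℤΣ.sum (lookup ps) ℤ.+ y)

  unitNumerator : Vec ℤ n → ℤ → Fin n → ℤ
  unitNumerator ps y i = + 2 ^ toℕ i ℤ.* facetValue ps y i

  numerators : Vec ℤ n → ℤ → Vec ℤ (suc n)
  numerators ps y = tabulate (unitNumerator ps y) ∷ʳ y

  unitNumerator≡ : ∀ ps y i → unitNumerator ps y i ≡ + N ℤ.* lookup ps i ℤ.+ y ℤ.* + 2 ^ toℕ i
  unitNumerator≡ ps y i = begin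
    + 2 ^ toℕ i ℤ.* (+ (m ℕ.* 2 ^ (n ∸ toℕ i)) ℤ.* lookup ps i ℤ.+ y)
      ≡⟨ regroup (+ 2 ^ toℕ i) (+ (m ℕ.* 2 ^ (n ∸ toℕ i))) (lookup ps i) y ⟩
    + 2 ^ toℕ i ℤ.* + (m ℕ.* 2 ^ (n ∸ toℕ i)) ℤ.* lookup ps i ℤ.+ y ℤ.* + 2 ^ toℕ i
      ≡⟨ cong (λ c → c ℤ.* lookup ps i ℤ.+ y ℤ.* + 2 ^ toℕ i)
              (trans (sym (ℤ.pos-* (2 ^ toℕ i) (m ℕ.* 2 ^ (n ∸ toℕ i)))) (cong +_ (2^i*m2^[n∸i]≡N i))) ⟩
    + N ℤ.* lookup ps i ℤ.+ y ℤ.* + 2 ^ toℕ i ∎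
    where
    open ≡-Reasoning
    regroup : ∀ p c x y → p ℤ.* (c ℤ.* x ℤ.+ y) ≡ p ℤ.* c ℤ.* x ℤ.+ y ℤ.* p
    regroup = solve-∀

  module Barycentric (t : ℕ) .{{_ : ℕ.NonZero t}} (ps : Vec ℤ n) (y : ℤ) where

    instance
      tN-nonZero : ℕ.NonZero (t ℕ.* N)
      tN-nonZero = ℕ.m*n≢0 t N

    R : ℚ
    R = ℚ.1/ ι (+ (t ℕ.* N))

    ι[tN]≡ιt*ιN : ι (+ (t ℕ.* N)) ≡ ι (+ t) ℚ.* ι (+ N)
    ι[tN]≡ιt*ιN = trans (cong ι (ℤ.pos-* t N)) (ι-* (+ t) (+ N))

    ι[tN]*R≡1 : ι (+ (t ℕ.* N)) ℚ.* R ≡ 1ℚ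
    ι[tN]*R≡1 = ℚ.*-inverseʳ (ι (+ (t ℕ.* N)))

    p : Vec ℤ (suc n)
    p = ps ∷ʳ y

    p/t : Fin (suc n) → ℚ
    p/t j = ι (+ N ℤ.* lookup p j) ℚ.* R

    -- the barycentric coordinates of p/t, as integer numerators over t·m·2ⁿ
    barycentric : Fin (suc (suc n)) → ℚ
    barycentric Fin.zero = ι (+ 2 ^ n ℤ.* budget t ps y) ℚ.* R
    barycentric (Fin.suc k) = ι (lookup (numerators ps y) k) ℚ.* R

    barycentric-unit : ∀ i → barycentric (unit i) ≡ ι (unitNumerator ps y i) ℚ.* R
    barycentric-unit i = cong (λ a → ι a ℚ.* R)
      (trans (lookup-∷ʳ-inject₁ (tabulate (unitNumerator ps y)) y i) (Vec.lookup∘tabulate (unitNumerator ps y) i))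

    barycentric-apex : barycentric apex ≡ ι y ℚ.* R
    barycentric-apex = cong (λ a → ι a ℚ.* R) (lookup-∷ʳ-last (tabulate (unitNumerator ps y)) y)

    numerators-total : + 2 ^ n ℤ.* budget t ps y ℤ.+ (ℤΣ.sum (unitNumerator ps y) ℤ.+ y) ≡ + (t ℕ.* N)
    numerators-total = begin
      + 2 ^ n ℤ.* budget t ps y ℤ.+ (ℤΣ.sum (unitNumerator ps y) ℤ.+ y)
        ≡⟨ cong (λ s → + 2 ^ n ℤ.* budget t ps y ℤ.+ (s ℤ.+ y)) units ⟩
      + 2 ^ n ℤ.* budget t ps y ℤ.+ ((+ N ℤ.* S ℤ.+ y ℤ.* (+ 2 ^ n ℤ.- + 1)) ℤ.+ y)
        ≡⟨ cong (λ c → + 2 ^ n ℤ.* budget t ps y ℤ.+ ((c ℤ.* S ℤ.+ y ℤ.* (+ 2 ^ n ℤ.- + 1)) ℤ.+ y)) (ℤ.pos-* m (2 ^ n)) ⟩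
      + 2 ^ n ℤ.* (+ m ℤ.* + t ℤ.- (+ m ℤ.* S ℤ.+ y)) ℤ.+ ((+ m ℤ.* + 2 ^ n ℤ.* S ℤ.+ y ℤ.* (+ 2 ^ n ℤ.- + 1)) ℤ.+ y)
        ≡⟨ regroup (+ 2 ^ n) (+ m) (+ t) S y ⟩
      + t ℤ.* (+ m ℤ.* + 2 ^ n)
        ≡⟨ trans (ℤ.pos-* t N) (cong (ℤ._*_ (+ t)) (ℤ.pos-* m (2 ^ n))) ⟨
      + (t ℕ.* N) ∎
      where
      open ≡-Reasoning
      S = ℤΣ.sum (lookup ps)
      regroup : ∀ P m t S y → P ℤ.* (m ℤ.* t ℤ.- (m ℤ.* S ℤ.+ y)) ℤ.+ ((m ℤ.* P ℤ.* S ℤ.+ y ℤ.* (P ℤ.- + 1)) ℤ.+ y) ≡ t ℤ.* (m ℤ.* P)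
      regroup = solve-∀
      units : ℤΣ.sum (unitNumerator ps y) ≡ + N ℤ.* S ℤ.+ y ℤ.* (+ 2 ^ n ℤ.- + 1)
      units = begin
        ℤΣ.sum (unitNumerator ps y)
          ≡⟨ ℤΣ.sum-cong-≗ (unitNumerator≡ ps y) ⟩
        ℤΣ.sum (λ i → + N ℤ.* lookup ps i ℤ.+ y ℤ.* + 2 ^ toℕ i)
          ≡⟨ ℤΣ.∑-distrib-+ {n} (λ i → + N ℤ.* lookup ps i) (λ i → y ℤ.* + 2 ^ toℕ i) ⟩
        ℤΣ.sum (λ i → + N ℤ.* lookup ps i) ℤ.+ ℤΣ.sum {n} (λ i → y ℤ.* + 2 ^ toℕ i)
          ≡⟨ cong₂ ℤ._+_ (ℤΣ.*-distribˡ-sum (+ N) (lookup ps)) (ℤΣ.*-distribˡ-sum {n} y (λ i → + 2 ^ toℕ i)) ⟨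
        + N ℤ.* S ℤ.+ y ℤ.* ℤΣ.sum (λ (i : Fin n) → + 2 ^ toℕ i)
          ≡⟨ cong (λ s → + N ℤ.* S ℤ.+ y ℤ.* s) (∑-powers-of-two n) ⟩
        + N ℤ.* S ℤ.+ y ℤ.* (+ 2 ^ n ℤ.- + 1) ∎

    barycentric-total : ΣQ (suc (suc n)) barycentric ≡ 1ℚ
    barycentric-total = begin
      ΣQ (suc (suc n)) barycentric
        ≡⟨ ΣQ-vertices barycentric ⟩
      ι a₀ ℚ.* R ℚ.+ (ℚΣ.sum (barycentric ∘ unit) ℚ.+ barycentric apex)
        ≡⟨ cong₂ (λ s b → ι a₀ ℚ.* R ℚ.+ (s ℚ.+ b)) units barycentric-apex ⟩
      ι a₀ ℚ.* R ℚ.+ (ι (ℤΣ.sum a) ℚ.* R ℚ.+ ι y ℚ.* R)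
        ≡⟨ solve 4 (λ a s y r → a :* r :+ (s :* r :+ y :* r) := (a :+ (s :+ y)) :* r) refl (ι a₀) (ι (ℤΣ.sum a)) (ι y) R ⟩
      (ι a₀ ℚ.+ (ι (ℤΣ.sum a) ℚ.+ ι y)) ℚ.* R
        ≡⟨ cong (ℚ._* R) (trans (cong (ι a₀ ℚ.+_) (sym (ι-+ (ℤΣ.sum a) y))) (sym (ι-+ a₀ (ℤΣ.sum a ℤ.+ y)))) ⟩
      ι (a₀ ℤ.+ (ℤΣ.sum a ℤ.+ y)) ℚ.* R
        ≡⟨ cong (λ z → ι z ℚ.* R) numerators-total ⟩
      ι (+ (t ℕ.* N)) ℚ.* R
        ≡⟨ ι[tN]*R≡1 ⟩
      1ℚ ∎
      where
      open ≡-Reasoning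
      open +-*-Solver
      a₀ = + 2 ^ n ℤ.* budget t ps y
      a = unitNumerator ps y
      units : ℚΣ.sum (barycentric ∘ unit) ≡ ι (ℤΣ.sum a) ℚ.* R
      units = begin
        ℚΣ.sum (barycentric ∘ unit)     ≡⟨ ℚΣ.sum-cong-≗ barycentric-unit ⟩
        ℚΣ.sum (λ i → ι (a i) ℚ.* R)    ≡⟨ ℚΣ.*-distribʳ-sum R (ι ∘ a) ⟨
        ℚΣ.sum (ι ∘ a) ℚ.* R            ≡⟨ cong (ℚ._* R) (ι-sum a) ⟩
        ι (ℤΣ.sum a) ℚ.* R              ∎

    barycentric-combination : ∀ j → combination barycentric j ≡ p/t j
    barycentric-combination j with initOrLast j
    ... | init i = begin
      combination barycentric (inject₁ i)
        ≡⟨ combination-init barycentric i ⟩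
      barycentric (unit i) ℚ.+ barycentric apex ℚ.* ℚ.- P
        ≡⟨ cong₂ (λ u a → u ℚ.+ a ℚ.* ℚ.- P) (barycentric-unit i) barycentric-apex ⟩
      ι (unitNumerator ps y i) ℚ.* R ℚ.+ ι y ℚ.* R ℚ.* ℚ.- P
        ≡⟨ cong (λ z → ι z ℚ.* R ℚ.+ ι y ℚ.* R ℚ.* ℚ.- P) (unitNumerator≡ ps y i) ⟩
      ι (+ N ℤ.* lookup ps i ℤ.+ y ℤ.* + 2 ^ toℕ i) ℚ.* R ℚ.+ ι y ℚ.* R ℚ.* ℚ.- P
        ≡⟨ cong (λ z → z ℚ.* R ℚ.+ ι y ℚ.* R ℚ.* ℚ.- P)
                (trans (ι-+ (+ N ℤ.* lookup ps i) (y ℤ.* + 2 ^ toℕ i)) (cong (ι (+ N ℤ.* lookup ps i) ℚ.+_) (ι-* y (+ 2 ^ toℕ i)))) ⟩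
      (ι (+ N ℤ.* lookup ps i) ℚ.+ ι y ℚ.* P) ℚ.* R ℚ.+ ι y ℚ.* R ℚ.* ℚ.- P
        ≡⟨ solve 4 (λ x y p r → (x :+ y :* p) :* r :+ y :* r :* (:- p) := x :* r) refl (ι (+ N ℤ.* lookup ps i)) (ι y) P R ⟩
      ι (+ N ℤ.* lookup ps i) ℚ.* R
        ≡⟨ cong (λ x → ι (+ N ℤ.* x) ℚ.* R) (lookup-∷ʳ-inject₁ ps y i) ⟨
      ι (+ N ℤ.* lookup (ps ∷ʳ y) (inject₁ i)) ℚ.* R ∎
      where
      open ≡-Reasoning
      open +-*-Solver
      P = ι (+ 2 ^ toℕ i)
    ... | last = begin
      combination barycentric (fromℕ n)
        ≡⟨ combination-last barycentric ⟩
      barycentric apex ℚ.* ι (+ N)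
        ≡⟨ cong (ℚ._* ι (+ N)) barycentric-apex ⟩
      ι y ℚ.* R ℚ.* ι (+ N)
        ≡⟨ solve 3 (λ y r c → y :* r :* c := c :* y :* r) refl (ι y) R (ι (+ N)) ⟩
      ι (+ N) ℚ.* ι y ℚ.* R
        ≡⟨ cong (ℚ._* R) (trans (cong (λ x → ι (+ N ℤ.* x)) (lookup-∷ʳ-last ps y)) (ι-* (+ N) y)) ⟨
      ι (+ N ℤ.* lookup (ps ∷ʳ y) (fromℕ n)) ℚ.* R ∎
      where
      open ≡-Reasoning
      open +-*-Solver

    instance
      R-positive : ℚ.Positive R
      R-positive = ℚ.1/pos⇒pos (ι (+ (t ℕ.* N))) {{ℤ.positive (ℤ.+<+ (ℕ.>-nonZero⁻¹ (t ℕ.* N)))}}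

    nonNeg⇔ι*R : ∀ a → 0ℤ ℤ.≤ a ⇔ 0ℚ ℚ.≤ ι a ℚ.* R
    nonNeg⇔ι*R a = mk⇔
      (λ 0≤a → subst (ℚ._≤ ι a ℚ.* R) (ℚ.*-zeroˡ R) (ℚ.*-monoʳ-≤-nonNeg R {{ℚ.pos⇒nonNeg R}} (Equivalence.to ι-nonNeg⇔ 0≤a)))
      (λ 0≤aR → Equivalence.from ι-nonNeg⇔ (ℚ.*-cancelʳ-≤-pos R (subst (ℚ._≤ ι a ℚ.* R) (sym (ℚ.*-zeroˡ R)) 0≤aR)))

    barycentric-nonNeg⇔ : (∀ k → 0ℚ ℚ.≤ barycentric k) ⇔ InHalfspaces t ps y
    barycentric-nonNeg⇔ = mk⇔ to from
      where
      to : (∀ k → 0ℚ ℚ.≤ barycentric k) → InHalfspaces t ps y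
      to nonNeg = Equivalence.from (nonNeg⇔ι*R y) (subst (0ℚ ℚ.≤_) barycentric-apex (nonNeg apex))
                , (λ i → Equivalence.from (nonNeg⇔2^k* (toℕ i) _)
                           (Equivalence.from (nonNeg⇔ι*R _) (subst (0ℚ ℚ.≤_) (barycentric-unit i) (nonNeg (unit i)))))
                , ℤ.0≤i-j⇒j≤i (Equivalence.from (nonNeg⇔2^k* n _) (Equivalence.from (nonNeg⇔ι*R _) (nonNeg Fin.zero)))
      from : InHalfspaces t ps y → ∀ k → 0ℚ ℚ.≤ barycentric k
      from (_ , _ , budget≤) Fin.zero =
        Equivalence.to (nonNeg⇔ι*R _) (Equivalence.to (nonNeg⇔2^k* n _) (ℤ.i≤j⇒0≤j-i budget≤))
      from (0≤y , facets , _) (Fin.suc k) with initOrLast k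
      ... | init i = subst (0ℚ ℚ.≤_) (sym (barycentric-unit i))
                       (Equivalence.to (nonNeg⇔ι*R _) (Equivalence.to (nonNeg⇔2^k* (toℕ i) _) (facets i)))
      ... | last = subst (0ℚ ℚ.≤_) (sym barycentric-apex) (Equivalence.to (nonNeg⇔ι*R y) 0≤y)

    dilate : ∀ j → ι (+ t) ℚ.* p/t j ≡ ι (lookup p j)
    dilate j = begin
      ι (+ t) ℚ.* (ι (+ N ℤ.* x) ℚ.* R)          ≡⟨ cong (λ z → ι (+ t) ℚ.* (z ℚ.* R)) (ι-* (+ N) x) ⟩
      ι (+ t) ℚ.* (ι (+ N) ℚ.* ι x ℚ.* R)
        ≡⟨ solve 4 (λ a b c r → a :* (b :* c :* r) := c :* (a :* b :* r)) refl (ι (+ t)) (ι (+ N)) (ι x) R ⟩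
      ι x ℚ.* (ι (+ t) ℚ.* ι (+ N) ℚ.* R)        ≡⟨ cong (λ z → ι x ℚ.* (z ℚ.* R)) ι[tN]≡ιt*ιN ⟨
      ι x ℚ.* (ι (+ (t ℕ.* N)) ℚ.* R)            ≡⟨ cong (ι x ℚ.*_) ι[tN]*R≡1 ⟩
      ι x ℚ.* 1ℚ                                 ≡⟨ ℚ.*-identityʳ (ι x) ⟩
      ι x                                        ∎
      where
      open ≡-Reasoning
      open +-*-Solver
      x = lookup p j

    undilate : ∀ q j → ι (lookup p j) ≡ ι (+ t) ℚ.* q → q ≡ p/t j
    undilate q j x≡tq = begin
      q                                          ≡⟨ ℚ.*-identityʳ q ⟨
      q ℚ.* 1ℚ                                   ≡⟨ cong (q ℚ.*_) ι[tN]*R≡1 ⟨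
      q ℚ.* (ι (+ (t ℕ.* N)) ℚ.* R)              ≡⟨ cong (λ z → q ℚ.* (z ℚ.* R)) ι[tN]≡ιt*ιN ⟩
      q ℚ.* (ι (+ t) ℚ.* ι (+ N) ℚ.* R)
        ≡⟨ solve 4 (λ q a b r → q :* (a :* b :* r) := b :* (a :* q) :* r) refl q (ι (+ t)) (ι (+ N)) R ⟩
      ι (+ N) ℚ.* (ι (+ t) ℚ.* q) ℚ.* R          ≡⟨ cong (λ z → ι (+ N) ℚ.* z ℚ.* R) x≡tq ⟨
      ι (+ N) ℚ.* ι x ℚ.* R                      ≡⟨ cong (ℚ._* R) (ι-* (+ N) x) ⟨
      ι (+ N ℤ.* x) ℚ.* R                        ∎
      where
      open ≡-Reasoning
      open +-*-Solver
      x = lookup p j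

  inDilate⇔inHalfspaces : ∀ t .{{_ : ℕ.NonZero t}} ps y → InDilate t vertex (ps ∷ʳ y) ⇔ InHalfspaces t ps y
  inDilate⇔inHalfspaces t ps y = mk⇔ to from
    where
    open Barycentric t ps y
    to : InDilate t vertex p → InHalfspaces t ps y
    to (q , (λs , nonNeg , total , q≡combination) , dilation) =
      Equivalence.to barycentric-nonNeg⇔ (λ k → subst (0ℚ ℚ.≤_) (λs≡barycentric k) (nonNeg k))
      where
      q≡p/t : ∀ j → lookup q j ≡ p/t j
      q≡p/t j = undilate (lookup q j) j
        (trans (sym (ι-/1 (lookup p j))) (trans (dilation j) (cong (ℚ._* lookup q j) (ι-/1 (+ t)))))
      λs≡barycentric : ∀ k → λs k ≡ barycentric k
      λs≡barycentric = combination-injective λs barycentric (trans total (sym barycentric-total))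
        (λ j → trans (sym (q≡combination j)) (trans (q≡p/t j) (sym (barycentric-combination j))))
    from : InHalfspaces t ps y → InDilate t vertex p
    from halfspaces =
      tabulate p/t , (barycentric , Equivalence.from barycentric-nonNeg⇔ halfspaces , barycentric-total , q≡combination) , dilation
      where
      q≡combination : ∀ j → lookup (tabulate p/t) j ≡ combination barycentric j
      q≡combination j = trans (Vec.lookup∘tabulate p/t j) (sym (barycentric-combination j))
      dilation : ∀ j → lookup p j ℚ./ 1 ≡ (+ t ℚ./ 1) ℚ.* lookup (tabulate p/t) j
      dilation j = begin
        lookup p j ℚ./ 1                    ≡⟨ ι-/1 (lookup p j) ⟩
        ι (lookup p j)                      ≡⟨ dilate j ⟨
        ι (+ t) ℚ.* p/t j                   ≡⟨ cong₂ ℚ._*_ (ι-/1 (+ t)) (Vec.lookup∘tabulate p/t j) ⟨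
        (+ t ℚ./ 1) ℚ.* lookup (tabulate p/t) j ∎
        where open ≡-Reasoning

enumerate-latticePoints : ∀ n m-1 t .{{_ : ℕ.NonZero t}} →
  Enumerates (InDilate t (ΔVert (suc n) (suc m-1))) (map (Codes.toPoint m-1) (Codes.codes m-1 n t))
enumerate-latticePoints n m-1 t = enumerates-⇔ image⇔inDilate (enumerates-map toPoint toPoint-injective (codes-enumerate n t))
  where
  open Codes m-1
  open Simplex n m-1 using (inDilate⇔inHalfspaces)
  image⇔inDilate : ∀ p → Image toPoint (Admissible n t) p ⇔ InDilate t (ΔVert (suc n) (suc m-1)) p
  image⇔inDilate p with initLast p
  ... | ps , y , refl = ⇔-sym (⇔-trans (inDilate⇔inHalfspaces t ps y) (inHalfspaces⇔toPoint t ps y))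

corollary5p7 : (d m : ℕ) → 2 ≤ d → 1 ≤ m →
    Σ (ℕ → ℕ) λ i →
      (∀ t → 1 ≤ t → HasCard (InDilate t (ΔVert d m)) (i t)) ×
      (∀ n → timesOneMinusXPow (suc d) (ehrSeries i) n ≡ targetCoeff d m n)
corollary5p7 (suc n) (suc m-1) _ _ = pointCount (suc m-1) n , hasCard , series
  where
  open Codes m-1 using (codes; length-codes; toPoint)
  hasCard : ∀ t → 1 ≤ t → HasCard (InDilate t (ΔVert (suc n) (suc m-1))) (pointCount (suc m-1) n t)
  hasCard t@(suc _) _ with enumerate-latticePoints n m-1 t
  ... | unique , membership =
    map toPoint (codes n t) , unique , membership , trans (List.length-map toPoint (codes n t)) (length-codes n t)
  series : ∀ k → timesOneMinusXPow (suc (suc n)) (ehrSeries (pointCount (suc m-1) n)) k ≡ targetCoeff (suc n) (suc m-1) k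
  series k = trans (timesOneMinusXPow-cong (suc (suc n)) (ehrSeries-pointCount (suc m-1) n) k)
                   (timesOneMinusXPow-pointCount m-1 n k)
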